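{- Let $t,n\in\mathbb{N}$. There is an explicit bijection between the set $SC_t(n)$ of self-conjugate $t$-core partitions of $n$ and \[ \Big\{ (w_0, \dots, w_{\lfloor \frac t2 \rfloor-1})\in\mathbb{Z}^{\lfloor \frac t2 \rfloor} : \sum_{k=0}^{\lfloor \frac t2 \rfloor-1}w_k^2 = 4tn + \tfrac{t(t^2-1)}{6},\ w_k \equiv 2k+1 - t \pmod{2t} \text{ for all } k \Big\}. \]
   Context: A partition is a $t$-core if no hook length $h(j,k)=\lambda_j+\lambda'_k-j-k+1$ of a cell of its Ferrers–Young diagram is divisible by $t$, and is self-conjugate if it equals its conjugate (rows and columns interchanged). -}

module Defs where

open import Data.Nat using (ℕ; zero; suc; _+_; _*_; _∸_; _≤_; _<_; _≤?_; _⊔_)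
open import Data.Nat.Divisibility using (_∣_)
open import Data.Nat.DivMod using (_/_)
open import Data.List using (List; []; _∷_; length; map; filter; foldr; upTo)
open import Data.Nat.ListAction using (sum)
open import Data.List.Relation.Unary.All using (All)
open import Data.List.Relation.Unary.Linked using (Linked)
open import Data.Vec using (Vec; lookup)
import Data.Vec as V
open import Data.Fin using (Fin; toℕ)
open import Data.Integer as ℤ using (ℤ; +_)
import Data.Integer.Divisibility as ℤD
open import Data.Product using (Σ; ∃; _×_; proj₁)
open import Relation.Binary.PropositionalEquality using (_≡_)
open import Relation.Nullary using (¬_)

IsPartitionOf : ℕ → List ℕ → Set
IsPartitionOf n λs = Linked (λ a b → b ≤ a) λs × All (λ x → 1 ≤ x) λs × sum λs ≡ n

-- 0-indexed lookup with default 0 (λ_j = 0 beyond the last part)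
_!!_ : List ℕ → ℕ → ℕ
[] !! i = 0
(x ∷ xs) !! zero = x
(x ∷ xs) !! suc i = xs !! i

-- conjugate partition: λ'_k = #{ j : λ_j ≥ k }, for k = 1 .. max part
conj : List ℕ → List ℕ
conj λs = map (λ k → length (filter (λ x → suc k ≤? x) λs)) (upTo (foldr _⊔_ 0 λs))

SelfConjugate : List ℕ → Set
SelfConjugate λs = conj λs ≡ λs

-- hook length of the cell in row j = i+1, column k = c+1 (1-indexed):
-- h(j,k) = λ_j + λ'_k - j - k + 1
hook : List ℕ → ℕ → ℕ → ℕ
hook λs i c = (λs !! i) + (conj λs !! c) ∸ (i + c + 1)

IsCore : ℕ → List ℕ → Set
IsCore t λs = ∀ i c → i < length λs → c < (λs !! i) → ¬ (t ∣ hook λs i c)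

SC : ℕ → ℕ → Set
SC t n = Σ (List ℕ) (λ λs → IsPartitionOf n λs × SelfConjugate λs × IsCore t λs)

sumSq : {m : ℕ} → Vec ℤ m → ℤ
sumSq V.[] = + 0
sumSq (w V.∷ ws) = w ℤ.* w ℤ.+ sumSq ws

W : ℕ → ℕ → Set
W t n = Σ (Vec ℤ (t / 2)) (λ w →
          (sumSq w ≡ + (4 * t * n + (t * (t * t ∸ 1)) / 6))
        × (∀ (k : Fin (t / 2)) →
             (+ (2 * t)) ℤD.∣ (lookup w k ℤ.- (+ (2 * toℕ k + 1) ℤ.- + t))))

-- A bijection between the underlying sets (elements compared by their data,
-- i.e. the partition list resp. the integer vector; the membership proofs are
-- propositions and are ignored).
Bijection : ∀ {A B : Set} {P : A → Set} {Q : B → Set} → (Σ A P → Σ B Q) → Set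
Bijection {A} {B} {P} {Q} f =
    (∀ (x y : Σ A P) → proj₁ (f x) ≡ proj₁ (f y) → proj₁ x ≡ proj₁ y)
  × (∀ (y : Σ B Q) → Σ (Σ A P) (λ x → proj₁ (f x) ≡ proj₁ y))

module Submission where

-- A self-conjugate partition is a nest of diagonal hooks, determined by their arms a₀ > a₁ > …;
-- the hooks have lengths 2aᵢ + 1 summing to n, and the hook lengths of all cells are a + a' + 1
-- for arms a, a' and a - y for an arm a above a non-arm y. Put the arms as beads on an abacus
-- with t runners. The t-core condition then says exactly that every runner is filled from the
-- bottom and that of two opposite runners r and t - 1 - r at most one carries beads. Such a core is
-- therefore determined by the differences z_k = c_k - c_(t-1-k) of runner lengths for k < ⌊t/2⌋,
-- any integers z_k occur, and w_k = 2t z_k + 2k + 1 - t has w_k² - (2k + 1 - t)² equal to 4t times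
-- the sum of the diagonal hooks on the nonempty runner of the pair; summing over k gives
-- Σ w_k² = 4tn + Σ_k (t - 2k - 1)² = 4tn + (t³ - t)/6.

open import Defs
open import Data.Nat using (ℕ; suc; _≤_)
open import Data.Product using (Σ; _,_)

module Conjugation where

  open import Data.Nat
  open import Data.Nat.Properties
  open import Data.List using (List; []; _∷_; length; filter; foldr; upTo; applyUpTo)
  open import Data.List.Properties using (filter-accept; filter-reject; map-upTo; length-map; length-applyUpTo)
  open import Data.List.Relation.Unary.All as All using (All; []; _∷_)
  open import Data.List.Relation.Unary.AllPairs using (_∷_)
  open import Data.List.Relation.Unary.Linked as Linked using (Linked; []; _∷_)
  open import Data.List.Relation.Unary.Linked.Properties using (Linked⇒AllPairs)
  open import Relation.Binary.PropositionalEquality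
  open import Relation.Nullary using (¬_; yes; no)
  open import Data.Empty using (⊥-elim)
  open import Function using (_∘_; id)

  Decreasing : List ℕ → Set
  Decreasing = Linked (λ a b → b ≤ a)

  Positive : List ℕ → Set
  Positive = All (1 ≤_)

  Symmetric : List ℕ → Set
  Symmetric xs = ∀ i k → k < xs !! i → i < xs !! k

  <-extensional : ∀ {a b} → (∀ i → i < a → i < b) → (∀ i → i < b → i < a) → a ≡ b
  <-extensional {a} {b} f g = ≤-antisym (≮⇒≥ (λ b<a → <-irrefl refl (f b b<a))) (≮⇒≥ (λ a<b → <-irrefl refl (g a a<b)))

  !!-extensional : ∀ (xs ys : List ℕ) → length xs ≡ length ys → (∀ i → xs !! i ≡ ys !! i) → xs ≡ ys
  !!-extensional [] [] _ _ = refl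
  !!-extensional (x ∷ xs) (y ∷ ys) e f = cong₂ _∷_ (f 0) (!!-extensional xs ys (suc-injective e) (f ∘ suc))

  !!-beyond-length : ∀ xs {i} → length xs ≤ i → xs !! i ≡ 0
  !!-beyond-length [] _ = refl
  !!-beyond-length (x ∷ xs) {suc i} (s≤s p) = !!-beyond-length xs p

  positive-!! : ∀ {xs} → Positive xs → ∀ {i} → i < length xs → 0 < xs !! i
  positive-!! (p ∷ _) {zero} _ = p
  positive-!! (_ ∷ ps) {suc i} (s≤s q) = positive-!! ps q

  !!-pos⇒<length : ∀ xs {i} → 0 < xs !! i → i < length xs
  !!-pos⇒<length (x ∷ xs) {zero} _ = s≤s z≤n
  !!-pos⇒<length (x ∷ xs) {suc i} q = s≤s (!!-pos⇒<length xs q)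

  applyUpTo-!! : ∀ (h : ℕ → ℕ) {m k} → k < m → applyUpTo h m !! k ≡ h k
  applyUpTo-!! h {suc m} {zero} _ = refl
  applyUpTo-!! h {suc m} {suc k} (s≤s p) = applyUpTo-!! (h ∘ suc) p

  applyUpTo-!!-≥ : ∀ (h : ℕ → ℕ) {m k} → m ≤ k → applyUpTo h m !! k ≡ 0
  applyUpTo-!!-≥ h {zero} _ = refl
  applyUpTo-!!-≥ h {suc m} {suc k} (s≤s p) = applyUpTo-!!-≥ (h ∘ suc) p

  decreasing-all : ∀ {x xs} → Decreasing (x ∷ xs) → All (_≤ x) xs
  decreasing-all d with Linked⇒AllPairs (λ p q → ≤-trans q p) d
  ... | p ∷ _ = p

  decreasing-!!≤head : ∀ {x} xs → Decreasing (x ∷ xs) → ∀ i → (x ∷ xs) !! i ≤ x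
  decreasing-!!≤head xs d zero = ≤-refl
  decreasing-!!≤head [] d (suc i) = z≤n
  decreasing-!!≤head (y ∷ ys) (p ∷ d) (suc i) = ≤-trans (decreasing-!!≤head ys d i) p

  maximum : List ℕ → ℕ
  maximum = foldr _⊔_ 0

  All-≤-maximum : ∀ xs → All (_≤ maximum xs) xs
  All-≤-maximum [] = []
  All-≤-maximum (x ∷ xs) = m≤m⊔n x (maximum xs) ∷ All.map (λ p → ≤-trans p (m≤n⊔m x (maximum xs))) (All-≤-maximum xs)

  maximum-decreasing : ∀ xs → Decreasing xs → maximum xs ≡ xs !! 0
  maximum-decreasing [] _ = refl
  maximum-decreasing (x ∷ xs) d = m≥n⇒m⊔n≡m (maximum≤ xs (decreasing-all d))
    where
    maximum≤ : ∀ ys {b} → All (_≤ b) ys → maximum ys ≤ b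
    maximum≤ [] _ = z≤n
    maximum≤ (y ∷ ys) (p ∷ ps) = ⊔-lub p (maximum≤ ys ps)

  countAbove : ℕ → List ℕ → ℕ
  countAbove k xs = length (filter (λ x → suc k ≤? x) xs)

  countAbove-accept : ∀ {k x} xs → k < x → countAbove k (x ∷ xs) ≡ suc (countAbove k xs)
  countAbove-accept {k} xs p = cong length (filter-accept (λ y → suc k ≤? y) p)

  countAbove-reject : ∀ {k x} xs → ¬ (k < x) → countAbove k (x ∷ xs) ≡ countAbove k xs
  countAbove-reject {k} xs p = cong length (filter-reject (λ y → suc k ≤? y) p)

  countAbove-≡0 : ∀ {k} xs → All (_≤ k) xs → countAbove k xs ≡ 0
  countAbove-≡0 [] _ = refl
  countAbove-≡0 (x ∷ xs) (p ∷ ps) = trans (countAbove-reject xs (≤⇒≯ p)) (countAbove-≡0 xs ps)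

  conj-!! : ∀ xs k → conj xs !! k ≡ countAbove k xs
  conj-!! xs k with k <? maximum xs
  ... | yes p = trans (cong (_!! k) (map-upTo _ (maximum xs))) (applyUpTo-!! _ p)
  ... | no p = trans (cong (_!! k) (map-upTo _ (maximum xs)))
                 (trans (applyUpTo-!!-≥ _ (≮⇒≥ p))
                   (sym (countAbove-≡0 xs (All.map (λ q → ≤-trans q (≮⇒≥ p)) (All-≤-maximum xs)))))

  <-countAbove⁻ : ∀ k xs → Decreasing xs → ∀ i → i < countAbove k xs → k < xs !! i
  <-countAbove⁻ k [] d i ()
  <-countAbove⁻ k (x ∷ xs) d i p with k <? x
  <-countAbove⁻ k (x ∷ xs) d zero p | yes q = q
  <-countAbove⁻ k (x ∷ xs) d (suc i) p | yes q rewrite countAbove-accept xs q =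
    <-countAbove⁻ k xs (Linked.tail d) i (≤-pred p)
  ... | no q rewrite countAbove-reject xs q
                   | countAbove-≡0 xs (All.map (λ r → ≤-trans r (≮⇒≥ q)) (decreasing-all d)) = ⊥-elim (n≮0 p)

  <-countAbove⁺ : ∀ k xs → Decreasing xs → ∀ i → k < xs !! i → i < countAbove k xs
  <-countAbove⁺ k (x ∷ xs) d i p with k <? x
  <-countAbove⁺ k (x ∷ xs) d zero p | yes q rewrite countAbove-accept xs q = s≤s z≤n
  <-countAbove⁺ k (x ∷ xs) d (suc i) p | yes q rewrite countAbove-accept xs q =
    s≤s (<-countAbove⁺ k xs (Linked.tail d) i p)
  ... | no q = ⊥-elim (q (≤-trans p (decreasing-!!≤head xs d i)))

  symmetric-length : ∀ {xs} → Positive xs → Symmetric xs → length xs ≡ xs !! 0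
  symmetric-length {xs} p s = <-extensional (λ i q → s i 0 (positive-!! p q)) (λ i q → !!-pos⇒<length xs (s 0 i q))

  selfConjugate⇒symmetric : ∀ {xs} → Decreasing xs → SelfConjugate xs → Symmetric xs
  selfConjugate⇒symmetric {xs} d sc i k q =
    subst (λ l → i < l !! k) sc (subst (i <_) (sym (conj-!! xs k)) (<-countAbove⁺ k xs d i q))

  symmetric⇒selfConjugate : ∀ {xs} → Decreasing xs → Positive xs → Symmetric xs → SelfConjugate xs
  symmetric⇒selfConjugate {xs} d p s = !!-extensional (conj xs) xs
    (trans (trans (length-map _ (upTo (maximum xs))) (length-applyUpTo id (maximum xs)))
           (trans (maximum-decreasing xs d) (sym (symmetric-length p s))))
    (λ k → trans (conj-!! xs k) (<-extensional (λ i q → s i k (<-countAbove⁻ k xs d i q))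
                                               (λ i q → <-countAbove⁺ k xs d i (s k i q))))

module DiagonalHooks where

  open Conjugation
  open import Data.Nat
  open import Data.Nat.Properties
  open import Data.Nat.ListAction using (sum)
  open import Data.Nat.ListAction.Properties using (sum-++)
  open import Data.List using (List; []; _∷_; length; map; _++_; replicate)
  open import Data.List.Properties using (length-map; length-++; length-replicate)
  open import Data.List.Relation.Unary.All using ([]; _∷_)
  open import Data.List.Relation.Unary.Linked as Linked using (Linked; []; [-]; _∷_)
  open import Data.Product using (Σ; _×_; _,_; proj₁; proj₂)
  open import Relation.Binary.PropositionalEquality
  open import Relation.Nullary using (yes; no)
  open import Data.Empty using (⊥-elim)
  open import Function using (_∘_)

  StrictlyDecreasing : List ℕ → Set
  StrictlyDecreasing = Linked (λ a b → b < a)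

  -- A self-conjugate partition is a nest of diagonal hooks; a hook with arm and leg a
  -- wraps μ by shifting it one step down the diagonal.
  addDiagonalHook : ℕ → List ℕ → List ℕ
  addDiagonalHook a μ = suc a ∷ (map suc μ ++ replicate (a ∸ length μ) 1)

  fromArms : List ℕ → List ℕ
  fromArms [] = []
  fromArms (a ∷ as) = addDiagonalHook a (fromArms as)

  firstRow : List ℕ → ℕ
  firstRow [] = 0
  firstRow (a ∷ _) = suc a

  diagonalHookSum : List ℕ → ℕ
  diagonalHookSum [] = 0
  diagonalHookSum (a ∷ as) = suc (a + a) + diagonalHookSum as

  module _ {a} (μ : List ℕ) (μ≤a : length μ ≤ a) where

    private
      tail-length : length (map suc μ ++ replicate (a ∸ length μ) 1) ≡ a
      tail-length = trans (length-++ (map suc μ)) (trans (cong₂ _+_ (length-map suc μ) (length-replicate _)) (m+[n∸m]≡n μ≤a))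

    addDiagonalHook-length : length (addDiagonalHook a μ) ≡ suc a
    addDiagonalHook-length = cong suc tail-length

    addDiagonalHook-!!-< : ∀ {i} → i < a → addDiagonalHook a μ !! suc i ≡ suc (μ !! i)
    addDiagonalHook-!!-< {i} i<a = go μ (a ∸ length μ) i (subst (i <_) (sym (m+[n∸m]≡n μ≤a)) i<a)
      where
      go : ∀ ν r i → i < length ν + r → (map suc ν ++ replicate r 1) !! i ≡ suc (ν !! i)
      go [] (suc r) zero _ = refl
      go [] (suc r) (suc i) (s≤s p) = go [] r i p
      go (m ∷ ν) r zero _ = refl
      go (m ∷ ν) r (suc i) (s≤s p) = go ν r i p

    addDiagonalHook-!!-≥ : ∀ {i} → a ≤ i → addDiagonalHook a μ !! suc i ≡ 0
    addDiagonalHook-!!-≥ a≤i = !!-beyond-length (map suc μ ++ replicate (a ∸ length μ) 1) (subst (_≤ _) (sym tail-length) a≤i)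

  firstRow≤ : ∀ {a} as → StrictlyDecreasing (a ∷ as) → firstRow as ≤ a
  firstRow≤ [] _ = z≤n
  firstRow≤ (b ∷ as) (p ∷ _) = p

  fromArms-!!0 : ∀ as → fromArms as !! 0 ≡ firstRow as
  fromArms-!!0 [] = refl
  fromArms-!!0 (a ∷ as) = refl

  fromArms-length : ∀ as → StrictlyDecreasing as → length (fromArms as) ≡ firstRow as
  inner-length≤ : ∀ {a} as → StrictlyDecreasing (a ∷ as) → length (fromArms as) ≤ a

  fromArms-length [] _ = refl
  fromArms-length (a ∷ as) s = addDiagonalHook-length (fromArms as) (inner-length≤ as s)

  inner-length≤ {a} as s = subst (_≤ a) (sym (fromArms-length as (Linked.tail s))) (firstRow≤ as s)

  fromArms-positive : ∀ as → Positive (fromArms as)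
  fromArms-positive [] = []
  fromArms-positive (a ∷ as) = s≤s z≤n ∷ positive-tail (fromArms as) (fromArms-positive as)
    where
    ones : ∀ r → Positive (replicate r 1)
    ones zero = []
    ones (suc r) = s≤s z≤n ∷ ones r
    positive-tail : ∀ μ → Positive μ → Positive (map suc μ ++ replicate (a ∸ length (fromArms as)) 1)
    positive-tail [] _ = ones _
    positive-tail (m ∷ μ) (_ ∷ ps) = s≤s z≤n ∷ positive-tail μ ps

  module _ {a as} (s : StrictlyDecreasing (a ∷ as)) where

    fromArms-!!-< : ∀ {i} → i < a → fromArms (a ∷ as) !! suc i ≡ suc (fromArms as !! i)
    fromArms-!!-< = addDiagonalHook-!!-< (fromArms as) (inner-length≤ as s)

    fromArms-!!-≥ : ∀ {i} → a ≤ i → fromArms (a ∷ as) !! suc i ≡ 0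
    fromArms-!!-≥ = addDiagonalHook-!!-≥ (fromArms as) (inner-length≤ as s)

  Antitone : List ℕ → Set
  Antitone xs = ∀ i → xs !! suc i ≤ xs !! i

  antitone⇒decreasing : ∀ xs → Antitone xs → Decreasing xs
  antitone⇒decreasing [] _ = []
  antitone⇒decreasing (x ∷ []) _ = [-]
  antitone⇒decreasing (x ∷ y ∷ r) p = p 0 ∷ antitone⇒decreasing (y ∷ r) (p ∘ suc)

  decreasing⇒antitone : ∀ xs → Decreasing xs → Antitone xs
  decreasing⇒antitone [] _ i = z≤n
  decreasing⇒antitone (x ∷ []) _ zero = z≤n
  decreasing⇒antitone (x ∷ []) _ (suc i) = z≤n
  decreasing⇒antitone (x ∷ y ∷ r) (p ∷ d) zero = p
  decreasing⇒antitone (x ∷ y ∷ r) (p ∷ d) (suc i) = decreasing⇒antitone (y ∷ r) d i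

  fromArms-antitone : ∀ as → StrictlyDecreasing as → Antitone (fromArms as)
  fromArms-antitone [] _ i = z≤n
  fromArms-antitone (a ∷ as) s zero with a ≟ 0
  ... | yes refl rewrite fromArms-!!-≥ s {0} z≤n = z≤n
  ... | no a≢0 rewrite fromArms-!!-< s (n≢0⇒n>0 a≢0) = s≤s (subst (_≤ a) (sym (fromArms-!!0 as)) (firstRow≤ as s))
  fromArms-antitone (a ∷ as) s (suc i) with suc i <? a
  ... | yes p rewrite fromArms-!!-< s p | fromArms-!!-< s (<-trans (n<1+n i) p) =
        s≤s (fromArms-antitone as (Linked.tail s) i)
  ... | no p rewrite fromArms-!!-≥ s (≮⇒≥ p) = z≤n

  fromArms-decreasing : ∀ as → StrictlyDecreasing as → Decreasing (fromArms as)
  fromArms-decreasing as s = antitone⇒decreasing (fromArms as) (fromArms-antitone as s)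

  fromArms-symmetric : ∀ as → StrictlyDecreasing as → Symmetric (fromArms as)
  fromArms-symmetric [] _ i k ()
  fromArms-symmetric (a ∷ as) s zero zero q = s≤s z≤n
  fromArms-symmetric (a ∷ as) s zero (suc k) (s≤s q) rewrite fromArms-!!-< s q = s≤s z≤n
  fromArms-symmetric (a ∷ as) s (suc i) k q with i <? a
  fromArms-symmetric (a ∷ as) s (suc i) zero q | yes p = s≤s p
  fromArms-symmetric (a ∷ as) s (suc i) (suc k) q | yes p rewrite fromArms-!!-< s p =
    subst (suc i <_) (sym (fromArms-!!-< s k<a)) (s≤s i<μk)
    where
    i<μk : i < fromArms as !! k
    i<μk = fromArms-symmetric as (Linked.tail s) i k (≤-pred q)
    k<a : k < a
    k<a = ≤-trans (!!-pos⇒<length (fromArms as) (≤-trans (s≤s z≤n) i<μk)) (inner-length≤ as s)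
  fromArms-symmetric (a ∷ as) s (suc i) k q | no p rewrite fromArms-!!-≥ s (≮⇒≥ p) = ⊥-elim (n≮0 q)

  fromArms-sum : ∀ as → StrictlyDecreasing as → sum (fromArms as) ≡ diagonalHookSum as
  fromArms-sum [] _ = refl
  fromArms-sum (a ∷ as) s = begin
    suc a + sum (map suc μ ++ replicate (a ∸ length μ) 1)
      ≡⟨ cong (suc a +_) (trans (sum-++ (map suc μ) _) (cong₂ _+_ (sum-map-suc μ) (sum-ones _))) ⟩
    suc a + (sum μ + length μ + (a ∸ length μ))
      ≡⟨ cong (suc a +_) (trans (+-assoc (sum μ) _ _) (cong (sum μ +_) (m+[n∸m]≡n (inner-length≤ as s)))) ⟩
    suc a + (sum μ + a)
      ≡⟨ cong (λ z → suc a + (z + a)) (fromArms-sum as (Linked.tail s)) ⟩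
    suc a + (diagonalHookSum as + a)
      ≡⟨ cong suc (trans (cong (a +_) (+-comm (diagonalHookSum as) a)) (sym (+-assoc a a (diagonalHookSum as)))) ⟩
    suc (a + a) + diagonalHookSum as ∎
    where
    open ≡-Reasoning
    μ = fromArms as
    sum-map-suc : ∀ ν → sum (map suc ν) ≡ sum ν + length ν
    sum-map-suc [] = refl
    sum-map-suc (m ∷ ν) = trans (cong (suc m +_) (sum-map-suc ν)) (trans (cong suc (sym (+-assoc m _ _))) (sym (+-suc (m + sum ν) _)))
    sum-ones : ∀ r → sum (replicate r 1) ≡ r
    sum-ones zero = refl
    sum-ones (suc r) = cong suc (sum-ones r)

  dropFirstColumn : List ℕ → List ℕ
  dropFirstColumn (suc (suc x) ∷ xs) = suc x ∷ dropFirstColumn xs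
  dropFirstColumn _ = []

  dropFirstColumn-!! : ∀ xs → Decreasing xs → ∀ i → dropFirstColumn xs !! i ≡ xs !! i ∸ 1
  dropFirstColumn-!! [] d i = refl
  dropFirstColumn-!! (zero ∷ xs) d i = sym (m≤n⇒m∸n≡0 {n = 1} (≤-trans (decreasing-!!≤head xs d i) z≤n))
  dropFirstColumn-!! (suc zero ∷ xs) d i = sym (m≤n⇒m∸n≡0 (decreasing-!!≤head xs d i))
  dropFirstColumn-!! (suc (suc x) ∷ xs) d zero = refl
  dropFirstColumn-!! (suc (suc x) ∷ xs) d (suc i) = dropFirstColumn-!! xs (Linked.tail d) i

  dropFirstColumn-positive : ∀ xs → Positive (dropFirstColumn xs)
  dropFirstColumn-positive (suc (suc x) ∷ xs) = s≤s z≤n ∷ dropFirstColumn-positive xs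
  dropFirstColumn-positive [] = []
  dropFirstColumn-positive (zero ∷ xs) = []
  dropFirstColumn-positive (suc zero ∷ xs) = []

  dropFirstColumn-length : ∀ xs → length (dropFirstColumn xs) ≤ length xs
  dropFirstColumn-length (suc (suc x) ∷ xs) = s≤s (dropFirstColumn-length xs)
  dropFirstColumn-length [] = z≤n
  dropFirstColumn-length (zero ∷ xs) = z≤n
  dropFirstColumn-length (suc zero ∷ xs) = z≤n

  -- The outer diagonal hook is the first row together with the first column; removing it leaves
  -- dropFirstColumn of the remaining rows.
  toArms : ∀ xs → Decreasing xs → Positive xs → Symmetric xs →
           Σ (List ℕ) (λ as → StrictlyDecreasing as × fromArms as ≡ xs)
  toArms xs = go (length xs) xs ≤-refl
    where
    go : ∀ bound xs → length xs ≤ bound → Decreasing xs → Positive xs → Symmetric xs →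
         Σ (List ℕ) (λ as → StrictlyDecreasing as × fromArms as ≡ xs)
    go _ [] _ _ _ _ = [] , [] , refl
    go zero (x ∷ xs) () _ _ _
    go (suc bound) (zero ∷ rest) _ _ (() ∷ _) _
    go (suc bound) xs@(suc a ∷ rest) (s≤s lb) d p sy =
      a ∷ as , cons firstRow≤a s , trans (cong (addDiagonalHook a) eq) (!!-extensional _ _ length-eq pointwise)
      where
      μ : List ℕ
      μ = dropFirstColumn rest
      μ-!! : ∀ i → μ !! i ≡ xs !! suc i ∸ 1
      μ-!! = dropFirstColumn-!! rest (Linked.tail d)
      μ-antitone : Antitone μ
      μ-antitone i = subst₂ _≤_ (sym (μ-!! (suc i))) (sym (μ-!! i)) (∸-monoˡ-≤ 1 (decreasing⇒antitone rest (Linked.tail d) i))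
      m<n∸1⇒m+1<n : ∀ {k m} → k < m ∸ 1 → suc k < m
      m<n∸1⇒m+1<n {m = suc m} q = s≤s q
      m+1<n⇒m<n∸1 : ∀ {k m} → suc k < m → k < m ∸ 1
      m+1<n⇒m<n∸1 {m = suc m} (s≤s q) = q
      μ-symmetric : Symmetric μ
      μ-symmetric i k q = subst (i <_) (sym (μ-!! k)) (m+1<n⇒m<n∸1 (sy (suc i) (suc k) (m<n∸1⇒m+1<n (subst (k <_) (μ-!! i) q))))
      inner : Σ (List ℕ) (λ as → StrictlyDecreasing as × fromArms as ≡ μ)
      inner = go bound μ (≤-trans (dropFirstColumn-length rest) lb) (antitone⇒decreasing μ μ-antitone)
                 (dropFirstColumn-positive rest) μ-symmetric
      as : List ℕ
      as = proj₁ inner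
      s : StrictlyDecreasing as
      s = proj₁ (proj₂ inner)
      eq : fromArms as ≡ μ
      eq = proj₂ (proj₂ inner)
      firstRow≤a : firstRow as ≤ a
      firstRow≤a = subst (_≤ a) (trans (sym (cong (_!! 0) eq)) (fromArms-!!0 as))
                     (subst (_≤ a) (sym (μ-!! 0)) (∸-monoˡ-≤ 1 (decreasing⇒antitone xs d 0)))
      cons : ∀ {bs} → firstRow bs ≤ a → StrictlyDecreasing bs → StrictlyDecreasing (a ∷ bs)
      cons {[]} _ _ = [-]
      cons {b ∷ _} q t = q ∷ t
      μ≤a : length μ ≤ a
      μ≤a = subst (_≤ a) (trans (sym (fromArms-length as s)) (cong length eq)) firstRow≤a
      xs-length : length xs ≡ suc a
      xs-length = symmetric-length p sy
      length-eq : length (addDiagonalHook a μ) ≡ length xs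
      length-eq = trans (addDiagonalHook-length μ μ≤a) (sym xs-length)
      pointwise : ∀ i → addDiagonalHook a μ !! i ≡ xs !! i
      pointwise zero = refl
      pointwise (suc i) with i <? a
      ... | yes q = trans (addDiagonalHook-!!-< μ μ≤a q) (trans (cong suc (μ-!! i)) (m+[n∸m]≡n (sy 0 (suc i) (s≤s q))))
      ... | no q = trans (addDiagonalHook-!!-≥ μ μ≤a (≮⇒≥ q))
                     (sym (!!-beyond-length xs (subst (_≤ suc i) (sym xs-length) (s≤s (≮⇒≥ q)))))

  fromArms-injective : ∀ as bs → StrictlyDecreasing as → StrictlyDecreasing bs → fromArms as ≡ fromArms bs → as ≡ bs
  fromArms-injective [] [] _ _ _ = refl
  fromArms-injective (a ∷ as) (b ∷ bs) sa sb e with suc-injective (cong (_!! 0) e)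
  ... | refl = cong (a ∷_) (fromArms-injective as bs (Linked.tail sa) (Linked.tail sb) (!!-extensional _ _ length-eq pointwise))
    where
    pointwise : ∀ i → fromArms as !! i ≡ fromArms bs !! i
    pointwise i with i <? a
    ... | yes q = suc-injective (trans (sym (fromArms-!!-< sa q)) (trans (cong (_!! suc i) e) (fromArms-!!-< sb q)))
    ... | no q = trans (!!-beyond-length (fromArms as) (≤-trans (inner-length≤ as sa) (≮⇒≥ q)))
                       (sym (!!-beyond-length (fromArms bs) (≤-trans (inner-length≤ bs sb) (≮⇒≥ q))))
    length-eq : length (fromArms as) ≡ length (fromArms bs)
    length-eq = trans (symmetric-length (fromArms-positive as) (fromArms-symmetric as (Linked.tail sa)))
                  (trans (pointwise 0) (sym (symmetric-length (fromArms-positive bs) (fromArms-symmetric bs (Linked.tail sb)))))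

module HookLengths where

  open Conjugation
  open DiagonalHooks
  open import Data.Nat
  open import Data.Nat.Properties
  open import Data.Nat.Tactic.RingSolver using (solve-∀)
  open import Data.Nat.Divisibility using (_∣_)
  open import Data.List using (List; []; _∷_)
  open import Data.List.Membership.Propositional using (_∈_; _∉_)
  open import Data.List.Relation.Unary.Any using (here; there)
  import Data.List.Relation.Unary.All as All
  open import Data.List.Relation.Unary.AllPairs using (_∷_)
  open import Data.List.Relation.Unary.Linked as Linked using (_∷_)
  open import Data.List.Relation.Unary.Linked.Properties using (Linked⇒AllPairs)
  open import Data.Product using (Σ; _×_; _,_)
  open import Data.Sum using (_⊎_; inj₁; inj₂)
  open import Relation.Binary.PropositionalEquality
  open import Relation.Binary using (tri<; tri≈; tri>)
  open import Relation.Nullary using (¬_; yes; no)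
  open import Data.Empty using (⊥-elim)

  ∈⇒<head : ∀ {a as y} → StrictlyDecreasing (a ∷ as) → y ∈ as → y < a
  ∈⇒<head s m with Linked⇒AllPairs (λ p q → <-trans q p) s
  ... | below ∷ _ = All.lookup below m

  ∈⇒<firstRow : ∀ {as x} → StrictlyDecreasing as → x ∈ as → x < firstRow as
  ∈⇒<firstRow s (here refl) = ≤-refl
  ∈⇒<firstRow s (there m) = <-trans (∈⇒<head s m) ≤-refl

  ∈-extensional : ∀ xs ys → StrictlyDecreasing xs → StrictlyDecreasing ys →
                  (∀ x → x ∈ xs → x ∈ ys) → (∀ x → x ∈ ys → x ∈ xs) → xs ≡ ys
  ∈-extensional [] [] _ _ f g = refl
  ∈-extensional [] (y ∷ ys) _ _ f g with g y (here refl)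
  ... | ()
  ∈-extensional (x ∷ xs) [] _ _ f g with f x (here refl)
  ... | ()
  ∈-extensional (x ∷ xs) (y ∷ ys) sx sy f g with f x (here refl) | g y (here refl)
  ... | here refl | _ = cong (x ∷_) (∈-extensional xs ys (Linked.tail sx) (Linked.tail sy) f' g')
    where
    f' : ∀ z → z ∈ xs → z ∈ ys
    f' z m with f z (there m)
    ... | here refl = ⊥-elim (<-irrefl refl (∈⇒<head sx m))
    ... | there m' = m'
    g' : ∀ z → z ∈ ys → z ∈ xs
    g' z m with g z (there m)
    ... | here refl = ⊥-elim (<-irrefl refl (∈⇒<head sy m))
    ... | there m' = m'
  ... | there m | here refl = ⊥-elim (<-irrefl refl (∈⇒<head sy m))
  ... | there m | there m' = ⊥-elim (<-asym (∈⇒<head sy m) (∈⇒<head sx m'))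

  crossing-row⇒arm : ∀ as → StrictlyDecreasing as → ∀ c → c < fromArms as !! c →
                     Σ ℕ (λ a → a ∈ as × fromArms as !! c ≡ suc (a + c))
  crossing-row⇒arm (a ∷ as) s zero q = a , here refl , cong suc (sym (+-identityʳ a))
  crossing-row⇒arm (a ∷ as) s (suc c) q with c <? a
  ... | yes p rewrite fromArms-!!-< s p with crossing-row⇒arm as (Linked.tail s) c (≤-pred q)
  ...   | a' , m , e = a' , there m , cong suc (trans e (sym (+-suc a' c)))
  crossing-row⇒arm (a ∷ as) s (suc c) q | no p rewrite fromArms-!!-≥ s (≮⇒≥ p) = ⊥-elim (n≮0 q)

  arm⇒crossing-row : ∀ as → StrictlyDecreasing as → ∀ a → a ∈ as → Σ ℕ (λ c → fromArms as !! c ≡ suc (a + c))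
  arm⇒crossing-row (a ∷ as) s .a (here refl) = 0 , cong suc (sym (+-identityʳ a))
  arm⇒crossing-row (a ∷ as) s a' (there m) with arm⇒crossing-row as (Linked.tail s) a' m
  ... | c , e = suc c , trans (fromArms-!!-< s c<a) (cong suc (trans e (sym (+-suc a' c))))
    where
    c<a : c < a
    c<a = ≤-trans (!!-pos⇒<length (fromArms as) (subst (0 <_) (sym e) (s≤s z≤n))) (inner-length≤ as s)

  short-row⇒gap : ∀ as → StrictlyDecreasing as → ∀ c → fromArms as !! c ≤ c → (c ∸ fromArms as !! c) ∉ as
  short-row⇒gap (a ∷ as) s zero () m
  short-row⇒gap (a ∷ as) s (suc c) q m with c <? a
  ... | yes p rewrite fromArms-!!-< s p = not-in m
    where
    not-in : (c ∸ fromArms as !! c) ∉ (a ∷ as)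
    not-in (here e) = <-irrefl e (≤-<-trans (m∸n≤m c (fromArms as !! c)) p)
    not-in (there m') = short-row⇒gap as (Linked.tail s) c (≤-pred q) m'
  ... | no p rewrite fromArms-!!-≥ s (≮⇒≥ p) = not-in m
    where
    not-in : suc c ∉ (a ∷ as)
    not-in (here e) = <-irrefl (sym e) (s≤s (≮⇒≥ p))
    not-in (there m') = <-asym (∈⇒<head s m') (s≤s (≮⇒≥ p))

  gap⇒short-row : ∀ as → StrictlyDecreasing as → ∀ y → y ∉ as →
                  Σ ℕ (λ c → fromArms as !! c ≤ c × c ≡ y + fromArms as !! c)
  gap⇒short-row [] _ y _ = y , z≤n , sym (+-identityʳ y)
  gap⇒short-row (a ∷ as) s y y∉ with <-cmp y a
  ... | tri≈ _ e _ = ⊥-elim (y∉ (here e))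
  ... | tri> _ _ a<y = y , subst (_≤ y) (sym (row-y a<y)) z≤n , trans (sym (+-identityʳ y)) (cong (y +_) (sym (row-y a<y)))
    where
    row-y : ∀ {y} → a < y → fromArms (a ∷ as) !! y ≡ 0
    row-y {suc y'} (s≤s a≤y') = fromArms-!!-≥ s a≤y'
  ... | tri< y<a _ _ with gap⇒short-row as (Linked.tail s) y (λ m → y∉ (there m))
  ...   | c , le , e = suc c , subst (_≤ suc c) (sym row) (s≤s le) , trans (cong suc e) (trans (sym (+-suc y _)) (cong (y +_) (sym row)))
    where
    c<a : c < a
    c<a with c <? a
    ... | yes p = p
    ... | no p = ⊥-elim (<-irrefl refl (<-≤-trans y<a (subst (a ≤_)
                   (trans e (trans (cong (y +_) (!!-beyond-length (fromArms as) (≤-trans (inner-length≤ as s) (≮⇒≥ p)))) (+-identityʳ y)))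
                   (≮⇒≥ p))))
    row : fromArms (a ∷ as) !! suc c ≡ suc (fromArms as !! c)
    row = fromArms-!!-< s c<a

  HookValue : List ℕ → ℕ → Set
  HookValue as h = (Σ ℕ λ a → Σ ℕ λ a' → a ∈ as × a' ∈ as × h ≡ suc (a + a'))
                 ⊎ (Σ ℕ λ a → Σ ℕ λ y → a ∈ as × y ∉ as × y < a × h ≡ a ∸ y)

  private
    hook-arm-arm : ∀ a a' i c → suc (a + i) + suc (a' + c) ∸ (i + c + 1) ≡ suc (a + a')
    hook-arm-arm a a' i c = trans (cong (_∸ (i + c + 1)) (rearrange a a' i c)) (m+n∸m≡n (i + c + 1) (suc (a + a')))
      where
      rearrange : ∀ a a' i c → suc (a + i) + suc (a' + c) ≡ (i + c + 1) + suc (a + a')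
      rearrange = solve-∀

    hook-arm-gap : ∀ a i v y → suc (a + i) + v ∸ (i + (y + v) + 1) ≡ a ∸ y
    hook-arm-gap a i v y = trans (cong₂ _∸_ (e₁ a i v) (e₂ i y v)) ([m+n]∸[m+o]≡n∸o (suc (i + v)) a y)
      where
      e₁ : ∀ a i v → suc (a + i) + v ≡ suc (i + v) + a
      e₁ = solve-∀
      e₂ : ∀ i y v → i + (y + v) + 1 ≡ suc (i + v) + y
      e₂ = solve-∀

  module _ (as : List ℕ) (s : StrictlyDecreasing as) where

    private
      ν = fromArms as
      ν-symmetric = fromArms-symmetric as s

      arm-over-gap : ∀ i c → i < ν !! i → ν !! c ≤ c → c < ν !! i → HookValue as (ν !! i + ν !! c ∸ (i + c + 1))
      arm-over-gap i c i-crosses c-short q with crossing-row⇒arm as s i i-crosses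
      ... | a , ma , ea = inj₂ (a , y , ma , short-row⇒gap as s c c-short , y<a , hook-eq)
        where
        y = c ∸ ν !! c
        y+v≡c : y + ν !! c ≡ c
        y+v≡c = m∸n+n≡m c-short
        hook-eq : ν !! i + ν !! c ∸ (i + c + 1) ≡ a ∸ y
        hook-eq = subst (λ c' → ν !! i + ν !! c ∸ (i + c' + 1) ≡ a ∸ y) y+v≡c
                    (trans (cong (λ z → z + ν !! c ∸ (i + (y + ν !! c) + 1)) ea) (hook-arm-gap a i (ν !! c) y))
        y<a : y < a
        y<a = +-cancelʳ-≤ i (suc y) a
                (≤-trans (subst (_≤ y + ν !! c) (+-suc y i) (+-monoʳ-≤ y (ν-symmetric i c q)))
                         (≤-pred (subst (_< suc (a + i)) (sym y+v≡c) (subst (c <_) ea q))))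

    hook⇒HookValue : ∀ i c → c < ν !! i → HookValue as (ν !! i + ν !! c ∸ (i + c + 1))
    hook⇒HookValue i c q with i <? ν !! i | c <? ν !! c
    ... | yes i-crosses | yes c-crosses with crossing-row⇒arm as s i i-crosses | crossing-row⇒arm as s c c-crosses
    ...   | a , ma , ea | a' , ma' , ea' =
      inj₁ (a , a' , ma , ma' , trans (cong₂ (λ u w → u + w ∸ (i + c + 1)) ea ea') (hook-arm-arm a a' i c))
    hook⇒HookValue i c q | yes i-crosses | no c-short = arm-over-gap i c i-crosses (≮⇒≥ c-short) q
    hook⇒HookValue i c q | no i-short | yes c-crosses =
      subst (HookValue as) (cong₂ _∸_ (+-comm (ν !! c) (ν !! i)) (cong (_+ 1) (+-comm c i)))
        (arm-over-gap c i c-crosses (≮⇒≥ i-short) (ν-symmetric i c q))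
    hook⇒HookValue i c q | no i-short | no c-short =
      ⊥-elim (<-asym (<-≤-trans q (≮⇒≥ i-short)) (<-≤-trans (ν-symmetric i c q) (≮⇒≥ c-short)))

    HookValue⇒hook : ∀ h → HookValue as h → Σ ℕ λ i → Σ ℕ λ c → c < ν !! i × h ≡ ν !! i + ν !! c ∸ (i + c + 1)
    HookValue⇒hook h (inj₁ (a , a' , ma , ma' , e))
      with arm⇒crossing-row as s a ma | arm⇒crossing-row as s a' ma'
    ... | i , ei | c , ec =
      i , c , in-row-i , trans e (sym (trans (cong₂ (λ u w → u + w ∸ (i + c + 1)) ei ec) (hook-arm-arm a a' i c)))
      where
      in-row-i : c < ν !! i
      in-row-i with c ≤? i
      ... | yes c≤i = subst (c <_) (sym ei) (s≤s (≤-trans c≤i (m≤n+m i a)))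
      ... | no c≰i = ν-symmetric c i (<-trans (≰⇒> c≰i) (subst (c <_) (sym ec) (s≤s (m≤n+m c a'))))
    HookValue⇒hook h (inj₂ (a , y , ma , y∉ , y<a , e))
      with arm⇒crossing-row as s a ma | gap⇒short-row as s y y∉
    ... | i , ei | c , c-short , ec =
      i , c , in-row-i , trans e (sym (trans (cong (λ u → u + ν !! c ∸ (i + c + 1)) ei)
                                             (subst (λ c' → suc (a + i) + ν !! c ∸ (i + c' + 1) ≡ a ∸ y) (sym ec) (hook-arm-gap a i (ν !! c) y))))
      where
      in-row-i : c < ν !! i
      in-row-i with ν !! c ≤? i
      ... | yes v≤i = subst (c <_) (sym ei) (s≤s (subst (_≤ a + i) (sym ec) (+-mono-≤ (<⇒≤ y<a) v≤i)))
      ... | no v≰i = ν-symmetric c i (≰⇒> v≰i)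

    private
      hook-fromArms : ∀ i c → hook ν i c ≡ ν !! i + ν !! c ∸ (i + c + 1)
      hook-fromArms i c = cong (λ l → ν !! i + l !! c ∸ (i + c + 1))
        (symmetric⇒selfConjugate (fromArms-decreasing as s) (fromArms-positive as) ν-symmetric)

    isCore⇒hookValue-∤ : ∀ t → IsCore t ν → ∀ h → HookValue as h → ¬ (t ∣ h)
    isCore⇒hookValue-∤ t core h hv t∣h with HookValue⇒hook h hv
    ... | i , c , cell , e = core i c (!!-pos⇒<length ν (≤-<-trans z≤n cell)) cell (subst (t ∣_) (trans e (sym (hook-fromArms i c))) t∣h)

    hookValue-∤⇒isCore : ∀ t → (∀ h → HookValue as h → ¬ (t ∣ h)) → IsCore t ν
    hookValue-∤⇒isCore t ∤ i c _ cell t∣hook = ∤ _ (hook⇒HookValue i c cell) (subst (t ∣_) (hook-fromArms i c) t∣hook)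

module RangeSums where

  open import Data.Nat
  open import Data.Nat.Properties
  open import Data.Nat.DivMod using (_/_; _%_; m≡m%n+[m/n]*n; m*n/n≡m)
  open import Data.Nat.Tactic.RingSolver using (solve-∀)
  open import Relation.Binary.PropositionalEquality
  open import Relation.Nullary using (Dec; yes; no)
  open import Data.Empty using (⊥-elim)
  open import Data.Product using (Σ; _×_; _,_)
  open import Function using (_∘_)

  sumTo : ℕ → (ℕ → ℕ) → ℕ
  sumTo zero f = 0
  sumTo (suc n) f = f n + sumTo n f

  ifYes : ∀ {P : Set} → Dec P → ℕ → ℕ
  ifYes (yes _) v = v
  ifYes (no _) v = 0

  term≤sumTo : ∀ n f {r} → r < n → f r ≤ sumTo n f
  term≤sumTo (suc n) f {r} p with r ≟ n
  ... | yes refl = m≤m+n (f r) _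
  ... | no q = ≤-trans (term≤sumTo n f (≤∧≢⇒< (≤-pred p) q)) (m≤n+m _ (f n))

  sumTo-cong : ∀ n {f g} → (∀ x → x < n → f x ≡ g x) → sumTo n f ≡ sumTo n g
  sumTo-cong zero h = refl
  sumTo-cong (suc n) h = cong₂ _+_ (h n ≤-refl) (sumTo-cong n (λ x p → h x (m≤n⇒m≤1+n p)))

  sumTo-+ : ∀ n f g → sumTo n (λ x → f x + g x) ≡ sumTo n f + sumTo n g
  sumTo-+ zero f g = refl
  sumTo-+ (suc n) f g rewrite sumTo-+ n f g = interchange (f n) (g n) (sumTo n f) (sumTo n g)
    where
    interchange : ∀ a b c d → a + b + (c + d) ≡ a + c + (b + d)
    interchange = solve-∀

  sumTo-* : ∀ n a f → sumTo n (λ k → a * f k) ≡ a * sumTo n f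
  sumTo-* zero a f = sym (*-zeroʳ a)
  sumTo-* (suc n) a f rewrite sumTo-* n a f = sym (*-distribˡ-+ a (f n) (sumTo n f))

  sumTo-shift : ∀ n f → sumTo (suc n) f ≡ f 0 + sumTo n (f ∘ suc)
  sumTo-shift zero f = refl
  sumTo-shift (suc n) f rewrite sumTo-shift n f = x+[y+z]≡y+[x+z] (f (suc n)) (f 0) _
    where
    x+[y+z]≡y+[x+z] : ∀ x y z → x + (y + z) ≡ y + (x + z)
    x+[y+z]≡y+[x+z] = solve-∀

  sumTo-split : ∀ m n f → sumTo (m + n) f ≡ sumTo m (λ x → f (x + n)) + sumTo n f
  sumTo-split zero n f = refl
  sumTo-split (suc m) n f rewrite sumTo-split m n f = sym (+-assoc (f (m + n)) _ _)

  sumTo-swap : ∀ m n (f : ℕ → ℕ → ℕ) → sumTo m (λ j → sumTo n (f j)) ≡ sumTo n (λ r → sumTo m (λ j → f j r))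
  sumTo-swap zero n f = sym (sumTo-zero n)
    where
    sumTo-zero : ∀ n → sumTo n (λ _ → 0) ≡ 0
    sumTo-zero zero = refl
    sumTo-zero (suc n) = sumTo-zero n
  sumTo-swap (suc m) n f rewrite sumTo-swap m n f = sym (sumTo-+ n (f m) (λ r → sumTo m (λ j → f j r)))

  sumTo-blocks : ∀ m t f → sumTo (m * t) f ≡ sumTo m (λ j → sumTo t (λ r → f (r + j * t)))
  sumTo-blocks zero t f = refl
  sumTo-blocks (suc m) t f rewrite sumTo-split t (m * t) f | sumTo-blocks m t f = refl

  sumTo-reverse : ∀ n f → sumTo n f ≡ sumTo n (λ k → f (n ∸ 1 ∸ k))
  sumTo-reverse zero f = refl
  sumTo-reverse (suc n) f = begin
    f n + sumTo n f                         ≡⟨ cong (f n +_) (sumTo-reverse n f) ⟩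
    f n + sumTo n (λ k → f (n ∸ 1 ∸ k))     ≡⟨ cong (f n +_) (sumTo-cong n (λ k _ → cong f (∸-+-assoc n 1 k))) ⟩
    f (n ∸ 0) + sumTo n (λ k → f (n ∸ suc k)) ≡⟨ sumTo-shift n (λ k → f (n ∸ k)) ⟨
    sumTo (suc n) (λ k → f (n ∸ k))         ∎
    where open ≡-Reasoning

  sumTo-truncate : ∀ k d f → sumTo (k + d) (λ j → ifYes (j <? k) (f j)) ≡ sumTo k f
  sumTo-truncate k zero f = trans (cong (λ z → sumTo z (λ j → ifYes (j <? k) (f j))) (+-identityʳ k)) (sumTo-cong k below)
    where
    below : ∀ x → x < k → ifYes (x <? k) (f x) ≡ f x
    below x p with x <? k
    ... | yes _ = refl
    ... | no q = ⊥-elim (q p)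
  sumTo-truncate k (suc d) f rewrite +-suc k d | sumTo-truncate k d f with k + d <? k
  ... | yes p = ⊥-elim (<-irrefl refl (<-≤-trans p (m≤m+n k d)))
  ... | no _ = refl

  -- Σ_{j<k} (2 (r + j t) + 1): the diagonal hooks of the beads r, r + t, …, r + (k - 1) t.
  runnerSum : ℕ → ℕ → ℕ → ℕ
  runnerSum t r k = sumTo k (λ j → suc ((r + j * t) + (r + j * t)))

  downClosed⇒initialSegment : (P : ℕ → Set) → (∀ j → Dec (P j)) → (∀ j → P (suc j) → P j) → ∀ bound → (∀ j → P j → j < bound) →
                              Σ ℕ (λ c → (∀ j → j < c → P j) × (∀ j → P j → j < c))
  downClosed⇒initialSegment P P? closed zero bounded = 0 , (λ j ()) , bounded
  downClosed⇒initialSegment P P? closed (suc b) bounded with P? b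
  ... | yes p = suc b , (λ j q → down (b ∸ j) j (subst P (sym (m∸n+n≡m (≤-pred q))) p)) , bounded
    where
    down : ∀ d j → P (d + j) → P j
    down zero j x = x
    down (suc d) j x = down d j (closed (d + j) x)
  ... | no p = downClosed⇒initialSegment P P? closed b (λ j x → ≤∧≢⇒< (≤-pred (bounded j x)) (λ e → p (subst P e x)))

  runnerSum-closed : ∀ t r p → runnerSum t r p + t * p ≡ p * (2 * r + 1) + t * p * p
  runnerSum-closed t r zero = trans (*-zeroʳ t) (sym (*-zeroʳ (t * 0)))
  runnerSum-closed t r (suc p) = begin
    suc (r + p * t + (r + p * t)) + runnerSum t r p + t * suc p   ≡⟨ regroup (runnerSum t r p) t r p ⟩
    runnerSum t r p + t * p + suc (r + r + 2 * p * t + t)         ≡⟨ cong (_+ suc (r + r + 2 * p * t + t)) (runnerSum-closed t r p) ⟩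
    p * (2 * r + 1) + t * p * p + suc (r + r + 2 * p * t + t)     ≡⟨ expand t r p ⟩
    suc p * (2 * r + 1) + t * suc p * suc p                       ∎
    where
    open ≡-Reasoning
    regroup : ∀ S t r p → suc (r + p * t + (r + p * t)) + S + t * suc p ≡ S + t * p + suc (r + r + 2 * p * t + t)
    regroup = solve-∀
    expand : ∀ t r p → p * (2 * r + 1) + t * p * p + suc (r + r + 2 * p * t + t) ≡ suc p * (2 * r + 1) + t * suc p * suc p
    expand = solve-∀

  sumTo-pairs : ∀ s d f → sumTo (s + d + s) f ≡ sumTo s (λ k → f k + f (s + d + s ∸ 1 ∸ k)) + sumTo d (λ x → f (x + s))
  sumTo-pairs s d f = begin
    sumTo (s + d + s) f                                                ≡⟨ sumTo-split (s + d) s f ⟩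
    sumTo (s + d) (λ x → f (x + s)) + sumTo s f                        ≡⟨ cong (_+ sumTo s f) (sumTo-split s d (λ x → f (x + s))) ⟩
    sumTo s (λ x → f (x + d + s)) + sumTo d (λ x → f (x + s)) + sumTo s f
      ≡⟨ cong (λ z → z + sumTo d (λ x → f (x + s)) + sumTo s f) (trans (sumTo-reverse s _) (sumTo-cong s (λ k k<s → cong f (index k<s)))) ⟩
    sumTo s g + sumTo d (λ x → f (x + s)) + sumTo s f                  ≡⟨ rotate (sumTo s g) _ (sumTo s f) ⟩
    sumTo s f + sumTo s g + sumTo d (λ x → f (x + s))                  ≡⟨ cong (_+ sumTo d (λ x → f (x + s))) (sumTo-+ s f g) ⟨
    sumTo s (λ k → f k + g k) + sumTo d (λ x → f (x + s))              ∎
    where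
    open ≡-Reasoning
    g = λ k → f (s + d + s ∸ 1 ∸ k)
    rotate : ∀ a b c → a + b + c ≡ c + a + b
    rotate = solve-∀
    index : ∀ {k} → k < s → s ∸ 1 ∸ k + d + s ≡ s + d + s ∸ 1 ∸ k
    index {k} k<s with s ∸ suc k | m+[n∸m]≡n k<s
    ... | e | refl = begin
      k + e ∸ k + d + suc (k + e)       ≡⟨ cong (λ z → z + d + suc (k + e)) (m+n∸m≡n k e) ⟩
      e + d + suc (k + e)               ≡⟨ m+n∸m≡n k _ ⟨
      k + (e + d + suc (k + e)) ∸ k     ≡⟨ cong (_∸ k) (assoc k e d (suc (k + e))) ⟩
      k + e + d + suc (k + e) ∸ k       ∎
      where
      assoc : ∀ k e d x → k + (e + d + x) ≡ k + e + d + x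
      assoc = solve-∀

  -- With t = s + d + s (d ≤ 1), the offsets |2k + 1 - t| for k < s are t ∸ (2k + 1); reversed they
  -- are 2k + 1 + d, whose squares sum to (t³ - t) / 6.
  offsetSquareSum : ℕ → ℕ → ℕ
  offsetSquareSum t s = sumTo s (λ k → (t ∸ (2 * k + 1)) * (t ∸ (2 * k + 1)))

  offsetSquareSum-closed : ∀ s d → d ≤ 1 → 6 * offsetSquareSum (s + d + s) s + (s + d + s) ≡ (s + d + s) * (s + d + s) * (s + d + s)
  offsetSquareSum-closed s d d≤1 = trans (cong (λ z → 6 * z + (s + d + s)) reversed) (squares s)
    where
    sq : ℕ → ℕ
    sq k = (2 * k + 1 + d) * (2 * k + 1 + d)
    reversed : offsetSquareSum (s + d + s) s ≡ sumTo s sq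
    reversed = trans (sumTo-reverse s _) (sumTo-cong s (λ k k<s → cong (λ z → z * z) (term k<s)))
      where
      term : ∀ {k} → k < s → s + d + s ∸ (2 * (s ∸ 1 ∸ k) + 1) ≡ 2 * k + 1 + d
      term {k} k<s with s ∸ suc k | m+[n∸m]≡n k<s
      ... | e | refl = begin
        suc (k + e) + d + suc (k + e) ∸ (2 * (k + e ∸ k) + 1)   ≡⟨ cong (λ z → suc (k + e) + d + suc (k + e) ∸ (2 * z + 1)) (m+n∸m≡n k e) ⟩
        suc (k + e) + d + suc (k + e) ∸ (2 * e + 1)             ≡⟨ cong (_∸ (2 * e + 1)) (split k e d) ⟩
        2 * k + 1 + d + (2 * e + 1) ∸ (2 * e + 1)               ≡⟨ m+n∸n≡m _ (2 * e + 1) ⟩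
        2 * k + 1 + d                                           ∎
        where
        open ≡-Reasoning
        split : ∀ k e d → suc (k + e) + d + suc (k + e) ≡ 2 * k + 1 + d + (2 * e + 1)
        split = solve-∀
    squares : ∀ s → 6 * sumTo s sq + (s + d + s) ≡ (s + d + s) * (s + d + s) * (s + d + s)
    squares zero = base d d≤1
      where
      base : ∀ d → d ≤ 1 → 0 + d + 0 ≡ (0 + d + 0) * (0 + d + 0) * (0 + d + 0)
      base zero _ = refl
      base (suc zero) _ = refl
      base (suc (suc _)) (s≤s ())
    squares (suc s) = begin
      6 * (sq s + sumTo s sq) + (suc s + d + suc s)               ≡⟨ regroup (sq s) (sumTo s sq) s d ⟩
      6 * sumTo s sq + (s + d + s) + (6 * sq s + 2)               ≡⟨ cong (_+ (6 * sq s + 2)) (squares s) ⟩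
      (s + d + s) * (s + d + s) * (s + d + s) + (6 * sq s + 2)   ≡⟨ cube s d d≤1 ⟩
      (suc s + d + suc s) * (suc s + d + suc s) * (suc s + d + suc s) ∎
      where
      open ≡-Reasoning
      regroup : ∀ x Q s d → 6 * (x + Q) + (suc s + d + suc s) ≡ 6 * Q + (s + d + s) + (6 * x + 2)
      regroup = solve-∀
      cube : ∀ s d → d ≤ 1 → (s + d + s) * (s + d + s) * (s + d + s) + (6 * ((2 * s + 1 + d) * (2 * s + 1 + d)) + 2)
                             ≡ (suc s + d + suc s) * (suc s + d + suc s) * (suc s + d + suc s)
      cube s zero _ = cube₀ s
        where
        cube₀ : ∀ s → (s + 0 + s) * (s + 0 + s) * (s + 0 + s) + (6 * ((2 * s + 1 + 0) * (2 * s + 1 + 0)) + 2)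
                      ≡ (suc s + 0 + suc s) * (suc s + 0 + suc s) * (suc s + 0 + suc s)
        cube₀ = solve-∀
      cube s (suc zero) _ = cube₁ s
        where
        cube₁ : ∀ s → (s + 1 + s) * (s + 1 + s) * (s + 1 + s) + (6 * ((2 * s + 1 + 1) * (2 * s + 1 + 1)) + 2)
                      ≡ (suc s + 1 + suc s) * (suc s + 1 + suc s) * (suc s + 1 + suc s)
        cube₁ = solve-∀
      cube s (suc (suc _)) (s≤s ())

  offsetSquareSum-/6 : ∀ s d → d ≤ 1 → (s + d + s) * ((s + d + s) * (s + d + s) ∸ 1) / 6 ≡ offsetSquareSum (s + d + s) s
  offsetSquareSum-/6 s d d≤1 = trans (cong (_/ 6) six-times) (m*n/n≡m (offsetSquareSum t s) 6)
    where
    t = s + d + s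
    six-times : t * (t * t ∸ 1) ≡ offsetSquareSum t s * 6
    six-times = begin
      t * (t * t ∸ 1)                   ≡⟨ *-distribˡ-∸ t (t * t) 1 ⟩
      t * (t * t) ∸ t * 1               ≡⟨ cong₂ _∸_ (sym (*-assoc t t t)) (*-identityʳ t) ⟩
      t * t * t ∸ t                     ≡⟨ cong (_∸ t) (offsetSquareSum-closed s d d≤1) ⟨
      6 * offsetSquareSum t s + t ∸ t   ≡⟨ m+n∸n≡m _ t ⟩
      6 * offsetSquareSum t s           ≡⟨ *-comm 6 (offsetSquareSum t s) ⟩
      offsetSquareSum t s * 6           ∎
      where open ≡-Reasoning

  n≡[n/2]+n%2+[n/2] : ∀ n → n ≡ n / 2 + n % 2 + n / 2
  n≡[n/2]+n%2+[n/2] n = trans (m≡m%n+[m/n]*n n 2) (shuffle (n % 2) (n / 2))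
    where
    shuffle : ∀ r h → r + h * 2 ≡ h + r + h
    shuffle = solve-∀

module Abacus (t' : ℕ) where

  open Conjugation using (<-extensional)
  open DiagonalHooks
  open HookLengths
  open RangeSums
  open import Data.Nat
  open import Data.Nat.Properties
  open import Data.Nat.DivMod
  open import Data.Nat.Tactic.RingSolver using (solve-∀)
  open import Data.Nat.Divisibility using (_∣_; divides; ∣-refl; ∣m+n∣m⇒∣n; n∣m*n)
  open import Data.List using (List; filter; downFrom)
  open import Data.List.Membership.Propositional using (_∈_)
  open import Data.List.Membership.Propositional.Properties using (∈-filter⁺; ∈-filter⁻; ∈-downFrom⁺)
  open import Data.List.Membership.DecPropositional _≟_ using (_∈?_)
  import Data.List.Relation.Unary.Linked.Properties as Linked
  open import Data.Product using (Σ; _×_; _,_; proj₁; proj₂)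
  open import Data.Sum using (_⊎_; inj₁; inj₂)
  open import Relation.Binary.PropositionalEquality
  open import Relation.Nullary using (¬_; Dec; yes; no)
  open import Data.Empty using (⊥; ⊥-elim)

  t : ℕ
  t = suc t'

  [r+j*t]%t≡r : ∀ {r} j → r < t → (r + j * t) % t ≡ r
  [r+j*t]%t≡r {r} j p = trans ([m+kn]%n≡m%n r j t) (m<n⇒m%n≡m p)

  [r+j*t]/t≡j : ∀ {r} j → r < t → (r + j * t) / t ≡ j
  [r+j*t]/t≡j {r} j p = trans (+-distrib-/ r (j * t) r%t+jt%t<t) (cong₂ _+_ (m<n⇒m/n≡0 p) (m*n/n≡m j t))
    where
    r%t+jt%t<t : r % t + (j * t) % t < t
    r%t+jt%t<t = subst (_< t) (sym (trans (cong₂ _+_ (m<n⇒m%n≡m p) (m*n%n≡0 j t)) (+-identityʳ r))) p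

  opposite : ℕ → ℕ
  opposite r = t ∸ 1 ∸ r

  OppositeEmpty : (ℕ → ℕ) → Set
  OppositeEmpty c = ∀ r → r < t → c r ≡ 0 ⊎ c (opposite r) ≡ 0

  -- The abacus with c r beads on runner r: position x lies on runner x % t at level x / t.
  beads : (ℕ → ℕ) → List ℕ
  beads c = filter (λ x → x / t <? c (x % t)) (downFrom (sumTo t c * t))

  beads-strictlyDecreasing : ∀ c → StrictlyDecreasing (beads c)
  beads-strictlyDecreasing c = Linked.filter⁺ (λ x → x / t <? c (x % t)) (λ p q → <-trans q p)
                                 (Linked.applyDownFrom⁺₁ (λ x → x) (sumTo t c * t) (λ {i} _ → n<1+n i))

  ∈-beads⁻ : ∀ c {x} → x ∈ beads c → x / t < c (x % t)
  ∈-beads⁻ c m = proj₂ (∈-filter⁻ (λ x → x / t <? c (x % t)) {xs = downFrom (sumTo t c * t)} m)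

  ∈-beads⁺ : ∀ c {x} → x / t < c (x % t) → x ∈ beads c
  ∈-beads⁺ c {x} p = ∈-filter⁺ (λ x → x / t <? c (x % t)) (∈-downFrom⁺ x<bound) p
    where
    x<bound : x < sumTo t c * t
    x<bound = begin-strict
      x                      ≡⟨ m≡m%n+[m/n]*n x t ⟩
      x % t + (x / t) * t    <⟨ +-monoˡ-< ((x / t) * t) (m%n<n x t) ⟩
      suc (x / t) * t        ≤⟨ *-monoˡ-≤ t (≤-trans p (term≤sumTo t c (m%n<n x t))) ⟩
      sumTo t c * t          ∎
      where open ≤-Reasoning

  beads-cong : ∀ c c' → (∀ r → r < t → c r ≡ c' r) → beads c ≡ beads c'
  beads-cong c c' h = ∈-extensional (beads c) (beads c') (beads-strictlyDecreasing c) (beads-strictlyDecreasing c')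
    (λ y m → ∈-beads⁺ c' (subst (y / t <_) (h (y % t) (m%n<n y t)) (∈-beads⁻ c m)))
    (λ y m → ∈-beads⁺ c (subst (y / t <_) (sym (h (y % t) (m%n<n y t))) (∈-beads⁻ c' m)))

  -- Two arms sum to t - 1 modulo t only if they lie on opposite runners, and a gap below an arm
  -- at a multiple of t is excluded since runners are filled from the bottom.
  beads-hookValue-∤ : ∀ c → OppositeEmpty c → ∀ h → HookValue (beads c) h → ¬ (t ∣ h)
  beads-hookValue-∤ c empty h (inj₁ (a , a' , ma , ma' , e)) t∣h = on-empty-runner (empty r (m%n<n a t))
    where
    r = a % t
    r' = a' % t
    h≡ : h ≡ suc (r + r') + (a / t + a' / t) * t
    h≡ = trans e (trans (cong₂ (λ u v → suc (u + v)) (m≡m%n+[m/n]*n a t) (m≡m%n+[m/n]*n a' t)) (regroup r r' (a / t) (a' / t) t))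
      where
      regroup : ∀ r r' j j' t → suc (r + j * t + (r' + j' * t)) ≡ suc (r + r') + (j + j') * t
      regroup = solve-∀
    t∣r+r'+1 : t ∣ suc (r + r')
    t∣r+r'+1 = ∣m+n∣m⇒∣n (subst (t ∣_) (trans h≡ (+-comm (suc (r + r')) _)) t∣h) (n∣m*n (a / t + a' / t))
    r+r'+1≡t : suc (r + r') ≡ t
    r+r'+1≡t with t∣r+r'+1
    ... | divides zero e = ⊥-elim (<-irrefl (sym e) (s≤s z≤n))
    ... | divides (suc zero) e = trans e (+-identityʳ t)
    ... | divides (suc (suc k)) e = ⊥-elim (<-irrefl refl (<-≤-trans r+r'+1<2t (subst (t + t ≤_) (sym e) (+-monoʳ-≤ t (m≤m+n t _)))))
      where
      r+r'+1<2t : suc (r + r') < t + t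
      r+r'+1<2t = subst (suc (suc (r + r')) ≤_) (sym (cong suc (+-suc t' t'))) (s≤s (s≤s (+-mono-≤ (≤-pred (m%n<n a t)) (≤-pred (m%n<n a' t)))))
    r'≡opposite-r : r' ≡ opposite r
    r'≡opposite-r = sym (trans (cong (λ z → z ∸ 1 ∸ r) (sym r+r'+1≡t)) (m+n∸m≡n r r'))
    on-empty-runner : c r ≡ 0 ⊎ c (opposite r) ≡ 0 → ⊥
    on-empty-runner (inj₁ z) = n≮0 (subst (a / t <_) z (∈-beads⁻ c ma))
    on-empty-runner (inj₂ z) = n≮0 (subst (a' / t <_) (trans (cong c r'≡opposite-r) z) (∈-beads⁻ c ma'))
  beads-hookValue-∤ c empty h (inj₂ (a , y , ma , y∉ , y<a , e)) (divides q eq) = y∉ (∈-beads⁺ c y-below)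
    where
    a≡ : a ≡ y % t + (y / t + q) * t
    a≡ = trans (sym (m∸n+n≡m (<⇒≤ y<a))) (trans (cong (_+ y) (trans (sym e) eq))
           (trans (cong (q * t +_) (m≡m%n+[m/n]*n y t)) (regroup (y % t) (y / t) q t)))
      where
      regroup : ∀ r j q t → q * t + (r + j * t) ≡ r + (j + q) * t
      regroup = solve-∀
    q≢0 : q ≢ 0
    q≢0 refl = <-irrefl (sym (trans a≡ (trans (cong (λ z → y % t + z * t) (+-identityʳ (y / t))) (sym (m≡m%n+[m/n]*n y t))))) y<a
    a-level : a / t ≡ y / t + q
    a-level = trans (cong (_/ t) a≡) ([r+j*t]/t≡j (y / t + q) (m%n<n y t))
    a-runner : a % t ≡ y % t
    a-runner = trans (cong (_% t) a≡) ([r+j*t]%t≡r (y / t + q) (m%n<n y t))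
    y-below : y / t < c (y % t)
    y-below = <-≤-trans (m<m+n (y / t) (n≢0⇒n>0 q≢0))
                (≤-trans (≤-reflexive (sym a-level)) (<⇒≤ (subst (λ z → a / t < c z) a-runner (∈-beads⁻ c ma))))

  beads-diagonalHookSum : ∀ c → diagonalHookSum (beads c) ≡ sumTo t (λ r → runnerSum t r (c r))
  beads-diagonalHookSum c = begin
    diagonalHookSum (beads c)                           ≡⟨ diagonalHookSum-filter (sumTo t c * t) _ ⟩
    sumTo (m * t) f                                     ≡⟨ sumTo-blocks m t f ⟩
    sumTo m (λ j → sumTo t (λ r → f (r + j * t)))       ≡⟨ sumTo-swap m t (λ j r → f (r + j * t)) ⟩
    sumTo t (λ r → sumTo m (λ j → f (r + j * t)))       ≡⟨ sumTo-cong t runner ⟩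
    sumTo t (λ r → runnerSum t r (c r))                 ∎
    where
    open ≡-Reasoning
    m = sumTo t c
    f = λ x → ifYes (x / t <? c (x % t)) (suc (x + x))
    diagonalHookSum-filter : ∀ N {P : ℕ → Set} (P? : ∀ x → Dec (P x)) →
                             diagonalHookSum (filter P? (downFrom N)) ≡ sumTo N (λ x → ifYes (P? x) (suc (x + x)))
    diagonalHookSum-filter zero P? = refl
    diagonalHookSum-filter (suc N) P? with P? N
    ... | yes _ = cong (suc (N + N) +_) (diagonalHookSum-filter N P?)
    ... | no _ = diagonalHookSum-filter N P?
    runner : ∀ r → r < t → sumTo m (λ j → f (r + j * t)) ≡ runnerSum t r (c r)
    runner r p = begin
      sumTo m (λ j → f (r + j * t))           ≡⟨ sumTo-cong m (λ j _ → on-runner j) ⟩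
      sumTo m g                               ≡⟨ cong (λ z → sumTo z g) (sym (m+[n∸m]≡n (term≤sumTo t c p))) ⟩
      sumTo (c r + (m ∸ c r)) g               ≡⟨ sumTo-truncate (c r) (m ∸ c r) _ ⟩
      runnerSum t r (c r)                     ∎
      where
      g = λ j → ifYes (j <? c r) (suc ((r + j * t) + (r + j * t)))
      on-runner : ∀ j → f (r + j * t) ≡ g j
      on-runner j rewrite [r+j*t]/t≡j j p | [r+j*t]%t≡r j p = refl

  module Runners (as : List ℕ) (s : StrictlyDecreasing as) (∤ : ∀ h → HookValue as h → ¬ (t ∣ h)) where

    arm-∸t : ∀ {a} → a ∈ as → t ≤ a → (a ∸ t) ∈ as
    arm-∸t {a} m t≤a with (a ∸ t) ∈? as
    ... | yes p = p
    ... | no p = ⊥-elim (∤ t (inj₂ (a , a ∸ t , m , p , ∸-monoʳ-< {o = 0} (s≤s z≤n) t≤a , sym (m∸[m∸n]≡n t≤a))) ∣-refl)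

    private
      OnRunner : ℕ → ℕ → Set
      OnRunner r j = (r + j * t) ∈ as

      onRunner-down : ∀ r j → OnRunner r (suc j) → OnRunner r j
      onRunner-down r j m = subst (_∈ as) (lower r j) (arm-∸t m (≤-trans (m≤m+n t (j * t)) (m≤n+m _ r)))
        where
        lower : ∀ r j → r + (t + j * t) ∸ t ≡ r + j * t
        lower r j = trans (cong (_∸ t) (x+[y+z]≡y+[x+z] r t (j * t))) (m+n∸m≡n t (r + j * t))
          where
          x+[y+z]≡y+[x+z] : ∀ x y z → x + (y + z) ≡ y + (x + z)
          x+[y+z]≡y+[x+z] = solve-∀

      runner : ∀ r → Σ ℕ (λ c → (∀ j → j < c → OnRunner r j) × (∀ j → OnRunner r j → j < c))
      runner r = downClosed⇒initialSegment (OnRunner r) (λ j → (r + j * t) ∈? as) (onRunner-down r) (firstRow as)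
                   (λ j m → ≤-<-trans (≤-trans (m≤m*n j t) (m≤n+m _ r)) (∈⇒<firstRow s m))

    runnerLength : ℕ → ℕ
    runnerLength r = proj₁ (runner r)

    ∈⇒<runnerLength : ∀ {x} → x ∈ as → x / t < runnerLength (x % t)
    ∈⇒<runnerLength {x} m = proj₂ (proj₂ (runner (x % t))) (x / t) (subst (_∈ as) (m≡m%n+[m/n]*n x t) m)

    <runnerLength⇒∈ : ∀ {x} → x / t < runnerLength (x % t) → x ∈ as
    <runnerLength⇒∈ {x} p = subst (_∈ as) (sym (m≡m%n+[m/n]*n x t)) (proj₁ (proj₂ (runner (x % t))) (x / t) p)

    -- Beads on two opposite runners r and t - 1 - r would give a hook length r + (t - 1 - r) + 1 = t.
    runnerLength-oppositeEmpty : OppositeEmpty runnerLength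
    runnerLength-oppositeEmpty r p with runnerLength r in e₁ | runnerLength (opposite r) in e₂
    ... | zero | _ = inj₁ refl
    ... | suc _ | zero = inj₂ refl
    ... | suc _ | suc _ = ⊥-elim (∤ t (inj₁ (r , opposite r , top r e₁ , top (opposite r) e₂ , t≡r+r'+1)) ∣-refl)
      where
      top : ∀ r {c} → runnerLength r ≡ suc c → r ∈ as
      top r e = subst (_∈ as) (+-identityʳ r) (proj₁ (proj₂ (runner r)) 0 (subst (0 <_) (sym e) (s≤s z≤n)))
      t≡r+r'+1 : t ≡ suc (r + opposite r)
      t≡r+r'+1 = cong suc (sym (m+[n∸m]≡n (≤-pred p)))

    beads-runnerLength : as ≡ beads runnerLength
    beads-runnerLength = ∈-extensional as (beads runnerLength) s (beads-strictlyDecreasing runnerLength)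
      (λ y m → ∈-beads⁺ runnerLength (∈⇒<runnerLength m))
      (λ y m → <runnerLength⇒∈ (∈-beads⁻ runnerLength m))

    runnerLength-beads : ∀ c → as ≡ beads c → ∀ r → r < t → runnerLength r ≡ c r
    runnerLength-beads c refl r p = <-extensional bead⇒<c <c⇒bead
      where
      bead⇒<c : ∀ j → j < runnerLength r → j < c r
      bead⇒<c j q = subst₂ _<_ ([r+j*t]/t≡j j p) (cong c ([r+j*t]%t≡r j p)) (∈-beads⁻ c (proj₁ (proj₂ (runner r)) j q))
      <c⇒bead : ∀ j → j < c r → j < runnerLength r
      <c⇒bead j q = proj₂ (proj₂ (runner r)) j (∈-beads⁺ c (subst₂ _<_ (sym ([r+j*t]/t≡j j p)) (cong c (sym ([r+j*t]%t≡r j p))) q))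

module Weights (t' : ℕ) where

  open RangeSums using (sumTo; sumTo-+; sumTo-*; sumTo-shift; sumTo-pairs; runnerSum; runnerSum-closed;
                        offsetSquareSum; offsetSquareSum-/6; n≡[n/2]+n%2+[n/2])
  open Abacus t' using (t; opposite; OppositeEmpty)
  open import Data.Nat as ℕ using (ℕ; zero; suc; _∸_; _<_; _≤_; s≤s; z≤n; _<?_)
  import Data.Nat.Properties as ℕₚ
  import Data.Nat.Tactic.RingSolver as ℕ-Solver
  open import Data.Nat.DivMod using (_/_; _%_; m%n<n; m/n<m)
  open import Data.Integer using (ℤ; +_; -[1+_]; _+_; _-_; _*_; -_)
  open import Data.Integer.Properties using (pos-+; pos-*; +-identityˡ; +-identityʳ; *-cancelˡ-≡; [+m]-[+n]≡m⊖n; ⊖-≥; ⊖-≤)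
  open import Data.Integer.Tactic.RingSolver using (solve-∀)
  open import Data.Vec using (Vec; tabulate; lookup)
  open import Data.Vec.Properties using (lookup∘tabulate; tabulate∘lookup; tabulate-cong)
  open import Data.Integer.Divisibility.Signed using (_∣_; divides)
  open import Data.Fin using (Fin; toℕ; fromℕ<)
  open import Data.Fin.Properties using (toℕ<n; toℕ-fromℕ<; fromℕ<-toℕ; fromℕ<-cong)
  open import Data.Sum using (_⊎_; inj₁; inj₂)
  open import Relation.Binary.PropositionalEquality
  open import Relation.Nullary using (¬_; Dec; yes; no)
  open import Data.Empty using (⊥-elim)
  open import Function using (_∘_)

  half : ℕ
  half = t / 2

  t≡half+t%2+half : t ≡ half ℕ.+ t % 2 ℕ.+ half
  t≡half+t%2+half = n≡[n/2]+n%2+[n/2] t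

  t%2≤1 : t % 2 ≤ 1
  t%2≤1 = ℕₚ.≤-pred (m%n<n t 2)

  r+opposite≡t∸1 : ∀ {r} → r < t → r ℕ.+ opposite r ≡ t ∸ 1
  r+opposite≡t∸1 r<t = ℕₚ.m+[n∸m]≡n (ℕₚ.≤-pred r<t)

  opposite-involutive : ∀ {r} → r < t → opposite (opposite r) ≡ r
  opposite-involutive r<t = ℕₚ.m∸[m∸n]≡n (ℕₚ.≤-pred r<t)

  opposite<t : ∀ r → opposite r < t
  opposite<t r = s≤s (ℕₚ.m∸n≤m t' r)

  <half⇒<t : ∀ {k} → k < half → k < t
  <half⇒<t k<half = ℕₚ.<-≤-trans k<half (ℕₚ.≤-trans (ℕₚ.m≤m+n half (t % 2)) (ℕₚ.≤-trans (ℕₚ.m≤m+n _ half) (ℕₚ.≤-reflexive (sym t≡half+t%2+half))))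

  half+half≤t : half ℕ.+ half ≤ t
  half+half≤t = ℕₚ.≤-trans (ℕₚ.+-monoˡ-≤ half (ℕₚ.m≤m+n half (t % 2))) (ℕₚ.≤-reflexive (sym t≡half+t%2+half))

  2k+1≤t : ∀ {k} → k < half → 2 ℕ.* k ℕ.+ 1 ≤ t
  2k+1≤t {k} k<half = ℕₚ.≤-trans (ℕₚ.≤-reflexive (two-k+1 k)) (ℕₚ.≤-trans (ℕₚ.+-mono-≤ k<half (ℕₚ.<⇒≤ k<half)) half+half≤t)
    where
    two-k+1 : ∀ k → 2 ℕ.* k ℕ.+ 1 ≡ suc k ℕ.+ k
    two-k+1 = ℕ-Solver.solve-∀

  half≤opposite : ∀ {k} → k < half → half ≤ opposite k
  half≤opposite {k} k<half = ℕₚ.+-cancelˡ-≤ k half (opposite k) (ℕₚ.≤-pred (begin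
    suc (k ℕ.+ half)        ≤⟨ ℕₚ.+-monoˡ-≤ half k<half ⟩
    half ℕ.+ half           ≤⟨ half+half≤t ⟩
    t                       ≡⟨ cong suc (r+opposite≡t∸1 (<half⇒<t k<half)) ⟨
    suc (k ℕ.+ opposite k)  ∎))
    where open ℕₚ.≤-Reasoning

  posPart : ℤ → ℕ
  posPart (+ n) = n
  posPart -[1+ n ] = 0

  negPart : ℤ → ℕ
  negPart (+ n) = 0
  negPart -[1+ n ] = suc n

  posPart-negPart : ∀ z → + posPart z - + negPart z ≡ z
  posPart-negPart (+ n) = +-identityʳ (+ n)
  posPart-negPart -[1+ n ] = refl

  posPart-[+m-+n] : ∀ m n → posPart (+ m - + n) ≡ m ∸ n
  posPart-[+m-+n] m n with ℕₚ.≤-total n m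
  ... | inj₁ n≤m = cong posPart (trans ([+m]-[+n]≡m⊖n m n) (⊖-≥ n≤m))
  ... | inj₂ m≤n = trans (cong posPart (trans ([+m]-[+n]≡m⊖n m n) (⊖-≤ m≤n))) (trans (posPart-neg (n ∸ m)) (sym (ℕₚ.m≤n⇒m∸n≡0 m≤n)))
    where
    posPart-neg : ∀ x → posPart (- + x) ≡ 0
    posPart-neg zero = refl
    posPart-neg (suc x) = refl

  negPart-[+m-+n] : ∀ m n → negPart (+ m - + n) ≡ n ∸ m
  negPart-[+m-+n] m n with ℕₚ.≤-total n m
  ... | inj₁ n≤m = trans (cong negPart (trans ([+m]-[+n]≡m⊖n m n) (⊖-≥ n≤m))) (sym (ℕₚ.m≤n⇒m∸n≡0 n≤m))
  ... | inj₂ m≤n = trans (cong negPart (trans ([+m]-[+n]≡m⊖n m n) (⊖-≤ m≤n))) (negPart-neg (n ∸ m))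
    where
    negPart-neg : ∀ x → negPart (- + x) ≡ x
    negPart-neg zero = refl
    negPart-neg (suc x) = refl

  ∸-one-empty : ∀ {m n} → m ≡ 0 ⊎ n ≡ 0 → m ∸ n ≡ m
  ∸-one-empty {n = n} (inj₁ refl) = ℕₚ.0∸n≡0 n
  ∸-one-empty (inj₂ refl) = refl

  difference : (ℕ → ℕ) → ℕ → ℤ
  difference c k = + c k - + c (opposite k)

  -- Inverse of difference on OppositeEmpty runner lengths: the sign of z k says which of the runners
  -- k and opposite k carries the beads.
  runnersFrom : (Fin half → ℤ) → ℕ → ℕ
  runnersFrom z r with r <? half
  ... | yes r<half = posPart (z (fromℕ< r<half))
  ... | no _ with opposite r <? half
  ...   | yes opp<half = negPart (z (fromℕ< opp<half))
  ...   | no _ = 0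

  runnersFrom-low : ∀ z {k} (k<half : k < half) → runnersFrom z k ≡ posPart (z (fromℕ< k<half))
  runnersFrom-low z {k} k<half with k <? half
  ... | yes _ = refl
  ... | no k≮half = ⊥-elim (k≮half k<half)

  runnersFrom-high : ∀ z {k} (k<half : k < half) → runnersFrom z (opposite k) ≡ negPart (z (fromℕ< k<half))
  runnersFrom-high z {k} k<half with opposite k <? half
  ... | yes opp<half = ⊥-elim (ℕₚ.<-irrefl refl (ℕₚ.<-≤-trans opp<half (half≤opposite k<half)))
  ... | no _ with opposite (opposite k) <? half
  ...   | yes q = cong (negPart ∘ z) (fromℕ<-cong _ _ (opposite-involutive (<half⇒<t k<half)) q k<half)
  ...   | no q = ⊥-elim (q (subst (_< half) (sym (opposite-involutive (<half⇒<t k<half))) k<half))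

  runnersFrom-middle : ∀ z {r} → ¬ r < half → ¬ opposite r < half → runnersFrom z r ≡ 0
  runnersFrom-middle z {r} r≮half opp≮half with r <? half
  ... | yes r<half = ⊥-elim (r≮half r<half)
  ... | no _ with opposite r <? half
  ...   | yes opp<half = ⊥-elim (opp≮half opp<half)
  ...   | no _ = refl

  t∸1≤half+half : t ∸ 1 ≤ half ℕ.+ half
  t∸1≤half+half = ℕₚ.≤-pred (begin
    t                       ≡⟨ t≡half+t%2+half ⟩
    half ℕ.+ t % 2 ℕ.+ half  ≤⟨ ℕₚ.+-monoˡ-≤ half (ℕₚ.+-monoʳ-≤ half t%2≤1) ⟩
    half ℕ.+ 1 ℕ.+ half      ≡⟨ middle-one half ⟩
    suc (half ℕ.+ half)      ∎)
    where
    open ℕₚ.≤-Reasoning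
    middle-one : ∀ h → h ℕ.+ 1 ℕ.+ h ≡ suc (h ℕ.+ h)
    middle-one = ℕ-Solver.solve-∀

  opposite-fixed : ∀ {r} → r < t → half ≤ r → half ≤ opposite r → opposite r ≡ r
  opposite-fixed {r} r<t half≤r half≤opp = trans (ℕₚ.≤-antisym opp≤half half≤opp) (ℕₚ.≤-antisym half≤r r≤half)
    where
    sum≤ : r ℕ.+ opposite r ≤ half ℕ.+ half
    sum≤ = ℕₚ.≤-trans (ℕₚ.≤-reflexive (r+opposite≡t∸1 r<t)) t∸1≤half+half
    r≤half : r ≤ half
    r≤half = ℕₚ.+-cancelʳ-≤ half r half (ℕₚ.≤-trans (ℕₚ.+-monoʳ-≤ r half≤opp) sum≤)
    opp≤half : opposite r ≤ half
    opp≤half = ℕₚ.+-cancelˡ-≤ half (opposite r) half (ℕₚ.≤-trans (ℕₚ.+-monoˡ-≤ (opposite r) half≤r) sum≤)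

  runnersFrom-oppositeEmpty : ∀ z → OppositeEmpty (runnersFrom z)
  runnersFrom-oppositeEmpty z r r<t = by-cases (r <? half) (opposite r <? half)
    where
    by-cases : Dec (r < half) → Dec (opposite r < half) → runnersFrom z r ≡ 0 ⊎ runnersFrom z (opposite r) ≡ 0
    by-cases (yes r<half) _ with z (fromℕ< r<half) in e
    ... | + _ = inj₂ (trans (runnersFrom-high z r<half) (cong negPart e))
    ... | -[1+ _ ] = inj₁ (trans (runnersFrom-low z r<half) (cong posPart e))
    by-cases (no _) (yes opp<half) with z (fromℕ< opp<half) in e
    ... | + _ = inj₁ (trans (cong (runnersFrom z) (sym (opposite-involutive r<t))) (trans (runnersFrom-high z opp<half) (cong negPart e)))
    ... | -[1+ _ ] = inj₂ (trans (runnersFrom-low z opp<half) (cong posPart e))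
    by-cases (no r≮half) (no opp≮half) = inj₁ (runnersFrom-middle z r≮half opp≮half)

  difference-runnersFrom : ∀ z (k : Fin half) → difference (runnersFrom z) (toℕ k) ≡ z k
  difference-runnersFrom z k = begin
    + runnersFrom z (toℕ k) - + runnersFrom z (opposite (toℕ k))  ≡⟨ cong₂ (λ a b → + a - + b) (runnersFrom-low z k<half) (runnersFrom-high z k<half) ⟩
    + posPart (z (fromℕ< k<half)) - + negPart (z (fromℕ< k<half))  ≡⟨ posPart-negPart _ ⟩
    z (fromℕ< k<half)                                             ≡⟨ cong z (fromℕ<-toℕ k k<half) ⟩
    z k                                                           ∎
    where
    open ≡-Reasoning
    k<half = toℕ<n k

  runnersFrom-difference : ∀ c → OppositeEmpty c → ∀ r → r < t → runnersFrom (difference c ∘ toℕ) r ≡ c r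
  runnersFrom-difference c empty r r<t = by-cases (r <? half) (opposite r <? half)
    where
    open ≡-Reasoning
    by-cases : Dec (r < half) → Dec (opposite r < half) → runnersFrom (difference c ∘ toℕ) r ≡ c r
    by-cases (yes r<half) _ = begin
      runnersFrom (difference c ∘ toℕ) r             ≡⟨ runnersFrom-low _ r<half ⟩
      posPart (difference c (toℕ (fromℕ< r<half)))   ≡⟨ cong (posPart ∘ difference c) (toℕ-fromℕ< r<half) ⟩
      posPart (+ c r - + c (opposite r))            ≡⟨ posPart-[+m-+n] (c r) (c (opposite r)) ⟩
      c r ∸ c (opposite r)                          ≡⟨ ∸-one-empty (empty r r<t) ⟩
      c r                                           ∎
    by-cases (no _) (yes opp<half) = begin
      runnersFrom (difference c ∘ toℕ) r                        ≡⟨ cong (runnersFrom _) (opposite-involutive r<t) ⟨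
      runnersFrom (difference c ∘ toℕ) (opposite (opposite r))  ≡⟨ runnersFrom-high _ opp<half ⟩
      negPart (difference c (toℕ (fromℕ< opp<half)))            ≡⟨ cong (negPart ∘ difference c) (toℕ-fromℕ< opp<half) ⟩
      negPart (+ c (opposite r) - + c (opposite (opposite r)))  ≡⟨ cong (λ r' → negPart (+ c (opposite r) - + c r')) (opposite-involutive r<t) ⟩
      negPart (+ c (opposite r) - + c r)                        ≡⟨ negPart-[+m-+n] (c (opposite r)) (c r) ⟩
      c r ∸ c (opposite r)                                      ≡⟨ ∸-one-empty (empty r r<t) ⟩
      c r                                                       ∎
    by-cases (no r≮half) (no opp≮half) = trans (runnersFrom-middle _ r≮half opp≮half) (sym c-r≡0)
      where
      c-r≡0 : c r ≡ 0
      c-r≡0 with empty r r<t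
      ... | inj₁ e = e
      ... | inj₂ e = trans (cong c (sym (opposite-fixed r<t (ℕₚ.≮⇒≥ r≮half) (ℕₚ.≮⇒≥ opp≮half)))) e

  offset : ℕ → ℤ
  offset k = + (2 ℕ.* k ℕ.+ 1) - + t

  weight : (ℕ → ℕ) → ℕ → ℤ
  weight c k = + (2 ℕ.* t) * difference c k + offset k

  weights : (ℕ → ℕ) → Vec ℤ half
  weights c = tabulate (weight c ∘ toℕ)

  private
    +[2k+1] : ∀ k → + (2 ℕ.* k ℕ.+ 1) ≡ + 2 * + k + + 1
    +[2k+1] k = trans (pos-+ (2 ℕ.* k) 1) (cong (_+ + 1) (pos-* 2 k))

    +[4tX+Y] : ∀ x y → + (4 ℕ.* t ℕ.* x ℕ.+ y) ≡ + 4 * + t * + x + + y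
    +[4tX+Y] x y = trans (pos-+ (4 ℕ.* t ℕ.* x) y) (cong (_+ + y) (trans (pos-* (4 ℕ.* t) x) (cong (_* + x) (pos-* 4 t))))

    +[t-1-k] : ∀ {k} → k < t → + opposite k ≡ + t - + 1 - + k
    +[t-1-k] {k} k<t = trans (cast-∸ (t ∸ 1) k (ℕₚ.≤-pred k<t)) (cong (_- + k) (cast-∸ t 1 (s≤s z≤n)))
      where
      cast-∸ : ∀ m n → n ≤ m → + (m ∸ n) ≡ + m - + n
      cast-∸ m n n≤m = sym (trans ([+m]-[+n]≡m⊖n m n) (⊖-≥ n≤m))

  runnerSum-ℤ : ∀ r p → + runnerSum t r p ≡ + p * (+ 2 * + r + + 1) + + t * + p * + p - + t * + p
  runnerSum-ℤ r p = begin
    + runnerSum t r p                                        ≡⟨ add-sub _ (+ t * + p) ⟩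
    + runnerSum t r p + + t * + p - + t * + p                ≡⟨ cong (λ z → + runnerSum t r p + z - + t * + p) (pos-* t p) ⟨
    + (runnerSum t r p ℕ.+ t ℕ.* p) - + t * + p              ≡⟨ cong (λ z → + z - + t * + p) (runnerSum-closed t r p) ⟩
    + (p ℕ.* (2 ℕ.* r ℕ.+ 1) ℕ.+ t ℕ.* p ℕ.* p) - + t * + p   ≡⟨ cong (_- + t * + p) casts ⟩
    + p * (+ 2 * + r + + 1) + + t * + p * + p - + t * + p    ∎
    where
    open ≡-Reasoning
    add-sub : ∀ a b → a ≡ a + b - b
    add-sub = solve-∀
    casts : + (p ℕ.* (2 ℕ.* r ℕ.+ 1) ℕ.+ t ℕ.* p ℕ.* p) ≡ + p * (+ 2 * + r + + 1) + + t * + p * + p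
    casts = trans (pos-+ (p ℕ.* (2 ℕ.* r ℕ.+ 1)) (t ℕ.* p ℕ.* p))
              (cong₂ _+_ (trans (pos-* p _) (cong (+ p *_) (+[2k+1] r)))
                         (trans (pos-* (t ℕ.* p) p) (cong (_* + p) (pos-* t p))))

  -- (2 t z + e)² = 4 t S + e² where S is the runner sum of z beads on runner k (z ≥ 0) or on runner
  -- opposite k (z < 0); for the latter, 2 (opposite k) + 1 = t - e.
  weight-square⁺ : ∀ k p → (+ (2 ℕ.* t) * + p + offset k) * (+ (2 ℕ.* t) * + p + offset k)
                           ≡ + 4 * + t * + runnerSum t k p + offset k * offset k
  weight-square⁺ k p = begin
    (+ (2 ℕ.* t) * + p + offset k) * (+ (2 ℕ.* t) * + p + offset k)   ≡⟨ cong₂ (λ A E → (A * + p + E) * (A * + p + E)) (pos-* 2 t) offset≡ ⟩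
    (+ 2 * T * P + E) * (+ 2 * T * P + E)                              ≡⟨ identity T (+ k) P ⟩
    + 4 * T * (P * (+ 2 * + k + + 1) + T * P * P - T * P) + E * E      ≡⟨ cong₂ (λ S E → + 4 * T * S + E * E) (runnerSum-ℤ k p) offset≡ ⟨
    + 4 * T * + runnerSum t k p + offset k * offset k                 ∎
    where
    open ≡-Reasoning
    T = + t
    P = + p
    E = + 2 * + k + + 1 - T
    offset≡ : offset k ≡ E
    offset≡ = cong (_- T) (+[2k+1] k)
    identity : ∀ T K P → (+ 2 * T * P + (+ 2 * K + + 1 - T)) * (+ 2 * T * P + (+ 2 * K + + 1 - T))
                       ≡ + 4 * T * (P * (+ 2 * K + + 1) + T * P * P - T * P) + (+ 2 * K + + 1 - T) * (+ 2 * K + + 1 - T)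
    identity = solve-∀

  weight-square⁻ : ∀ {k} → k < t → ∀ p → (+ (2 ℕ.* t) * - + p + offset k) * (+ (2 ℕ.* t) * - + p + offset k)
                                         ≡ + 4 * + t * + runnerSum t (opposite k) p + offset k * offset k
  weight-square⁻ {k} k<t p = begin
    (+ (2 ℕ.* t) * - P + offset k) * (+ (2 ℕ.* t) * - P + offset k)             ≡⟨ cong₂ (λ A E → (A * - P + E) * (A * - P + E)) (pos-* 2 t) offset≡ ⟩
    (+ 2 * T * - P + E) * (+ 2 * T * - P + E)                                    ≡⟨ identity T (+ k) P ⟩
    + 4 * T * (P * (+ 2 * (T - + 1 - + k) + + 1) + T * P * P - T * P) + E * E    ≡⟨ cong₂ (λ S E → + 4 * T * S + E * E) S≡ offset≡ ⟨
    + 4 * T * + runnerSum t (opposite k) p + offset k * offset k                ∎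
    where
    open ≡-Reasoning
    T = + t
    P = + p
    E = + 2 * + k + + 1 - T
    offset≡ : offset k ≡ E
    offset≡ = cong (_- T) (+[2k+1] k)
    S≡ : + runnerSum t (opposite k) p ≡ P * (+ 2 * (T - + 1 - + k) + + 1) + T * P * P - T * P
    S≡ = trans (runnerSum-ℤ (opposite k) p) (cong (λ R → P * (+ 2 * R + + 1) + T * P * P - T * P) (+[t-1-k] k<t))
    identity : ∀ T K P → (+ 2 * T * - P + (+ 2 * K + + 1 - T)) * (+ 2 * T * - P + (+ 2 * K + + 1 - T))
                       ≡ + 4 * T * (P * (+ 2 * (T - + 1 - K) + + 1) + T * P * P - T * P) + (+ 2 * K + + 1 - T) * (+ 2 * K + + 1 - T)
    identity = solve-∀

  offset-square : ∀ {k} → 2 ℕ.* k ℕ.+ 1 ≤ t → offset k * offset k ≡ + ((t ∸ (2 ℕ.* k ℕ.+ 1)) ℕ.* (t ∸ (2 ℕ.* k ℕ.+ 1)))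
  offset-square {k} m≤t = begin
    (+ m - + t) * (+ m - + t)        ≡⟨ square-neg (+ m) (+ t) ⟩
    (+ t - + m) * (+ t - + m)        ≡⟨ cong (λ z → z * z) (trans ([+m]-[+n]≡m⊖n t m) (⊖-≥ m≤t)) ⟩
    + (t ∸ m) * + (t ∸ m)            ≡⟨ pos-* (t ∸ m) (t ∸ m) ⟨
    + ((t ∸ m) ℕ.* (t ∸ m))          ∎
    where
    open ≡-Reasoning
    m = 2 ℕ.* k ℕ.+ 1
    square-neg : ∀ a b → (a - b) * (a - b) ≡ (b - a) * (b - a)
    square-neg = solve-∀

  runnerSums : (ℕ → ℕ) → ℕ → ℕ
  runnerSums c r = runnerSum t r (c r)

  weight-square : ∀ c → OppositeEmpty c → ∀ {k} → k < half →
                  weight c k * weight c k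
                  ≡ + (4 ℕ.* t ℕ.* (runnerSums c k ℕ.+ runnerSums c (opposite k)) ℕ.+ (t ∸ (2 ℕ.* k ℕ.+ 1)) ℕ.* (t ∸ (2 ℕ.* k ℕ.+ 1)))
  weight-square c empty {k} k<half with empty k (<half⇒<t k<half)
  ... | inj₂ opp≡0 = begin
    weight c k * weight c k                                      ≡⟨ cong (λ z → w z * w z) (trans (cong (λ m → + c k - + m) opp≡0) (+-identityʳ (+ c k))) ⟩
    w (+ c k) * w (+ c k)                                        ≡⟨ weight-square⁺ k (c k) ⟩
    + 4 * + t * + runnerSums c k + offset k * offset k            ≡⟨ cong₂ (λ x y → + 4 * + t * + x + y) (sym high-vanishes) (offset-square {k} (2k+1≤t k<half)) ⟩
    + 4 * + t * + X + + Y                                        ≡⟨ +[4tX+Y] X Y ⟨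
    + (4 ℕ.* t ℕ.* X ℕ.+ Y)                                      ∎
    where
    open ≡-Reasoning
    w = λ z → + (2 ℕ.* t) * z + offset k
    X = runnerSums c k ℕ.+ runnerSums c (opposite k)
    Y = (t ∸ (2 ℕ.* k ℕ.+ 1)) ℕ.* (t ∸ (2 ℕ.* k ℕ.+ 1))
    high-vanishes : runnerSums c k ℕ.+ runnerSums c (opposite k) ≡ runnerSums c k
    high-vanishes = trans (cong (λ m → runnerSums c k ℕ.+ runnerSum t (opposite k) m) opp≡0) (ℕₚ.+-identityʳ _)
  ... | inj₁ k≡0 = begin
    weight c k * weight c k                                      ≡⟨ cong (λ z → w z * w z) (trans (cong (λ m → + m - + c (opposite k)) k≡0) (+-identityˡ (- + c (opposite k)))) ⟩
    w (- + c (opposite k)) * w (- + c (opposite k))              ≡⟨ weight-square⁻ (<half⇒<t k<half) (c (opposite k)) ⟩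
    + 4 * + t * + runnerSums c (opposite k) + offset k * offset k  ≡⟨ cong₂ (λ x y → + 4 * + t * + x + y) (cong (λ m → runnerSum t k m ℕ.+ runnerSums c (opposite k)) k≡0) (sym (offset-square {k} (2k+1≤t k<half))) ⟨
    + 4 * + t * + X + + Y                                        ≡⟨ +[4tX+Y] X Y ⟨
    + (4 ℕ.* t ℕ.* X ℕ.+ Y)                                      ∎
    where
    open ≡-Reasoning
    w = λ z → + (2 ℕ.* t) * z + offset k
    X = runnerSums c k ℕ.+ runnerSums c (opposite k)
    Y = (t ∸ (2 ℕ.* k ℕ.+ 1)) ℕ.* (t ∸ (2 ℕ.* k ℕ.+ 1))

  sumSq-tabulate : ∀ n (f : ℕ → ℤ) (g : ℕ → ℕ) → (∀ {k} → k < n → f k * f k ≡ + g k) →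
                   sumSq (tabulate {n = n} (f ∘ toℕ)) ≡ + sumTo n g
  sumSq-tabulate zero f g sq = refl
  sumSq-tabulate (suc n) f g sq = begin
    f 0 * f 0 + sumSq (tabulate {n = n} (f ∘ suc ∘ toℕ))  ≡⟨ cong₂ _+_ (sq (s≤s z≤n)) (sumSq-tabulate n (f ∘ suc) (g ∘ suc) (sq ∘ s≤s)) ⟩
    + g 0 + + sumTo n (g ∘ suc)                           ≡⟨ pos-+ (g 0) _ ⟨
    + (g 0 ℕ.+ sumTo n (g ∘ suc))                         ≡⟨ cong +_ (sumTo-shift n g) ⟨
    + sumTo (suc n) g                                     ∎
    where open ≡-Reasoning

  sumTo-opposite-pairs : ∀ f → (t % 2 ≡ 1 → f half ≡ 0) → sumTo t f ≡ sumTo half (λ k → f k ℕ.+ f (opposite k))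
  sumTo-opposite-pairs f middle-vanishes = begin
    sumTo t f                                                              ≡⟨ cong (λ T → sumTo T f) t≡half+t%2+half ⟩
    sumTo (h ℕ.+ d ℕ.+ h) f                                                ≡⟨ sumTo-pairs h d f ⟩
    sumTo h (λ k → f k ℕ.+ f (h ℕ.+ d ℕ.+ h ∸ 1 ∸ k)) ℕ.+ sumTo d (λ x → f (x ℕ.+ h))
      ≡⟨ cong₂ ℕ._+_ (cong (λ T → sumTo h (λ k → f k ℕ.+ f (T ∸ 1 ∸ k))) (sym t≡half+t%2+half)) (middle d refl middle-vanishes) ⟩
    sumTo h (λ k → f k ℕ.+ f (opposite k)) ℕ.+ 0                            ≡⟨ ℕₚ.+-identityʳ _ ⟩
    sumTo h (λ k → f k ℕ.+ f (opposite k))                                  ∎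
    where
    open ≡-Reasoning
    h = half
    d = t % 2
    middle : ∀ e → e ≡ d → (e ≡ 1 → f half ≡ 0) → sumTo e (λ x → f (x ℕ.+ h)) ≡ 0
    middle zero _ _ = refl
    middle (suc zero) _ vanishes = trans (ℕₚ.+-identityʳ _) (vanishes refl)
    middle (suc (suc _)) e≡d _ = ⊥-elim (ℕₚ.<-irrefl refl (ℕₚ.≤-trans (s≤s (s≤s z≤n)) (ℕₚ.≤-trans (ℕₚ.≤-reflexive e≡d) (ℕₚ.≤-trans t%2≤1 (s≤s z≤n)))))

  sumSq-weights : ∀ c → OppositeEmpty c → sumSq (weights c) ≡ + (4 ℕ.* t ℕ.* sumTo t (runnerSums c) ℕ.+ (t ℕ.* (t ℕ.* t ∸ 1)) / 6)
  sumSq-weights c empty = trans (sumSq-tabulate half (weight c) _ (weight-square c empty)) (cong +_ total)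
    where
    open ≡-Reasoning
    middle-runner : t % 2 ≡ 1 → runnerSums c half ≡ 0
    middle-runner odd with empty half (m/n<m t 2 (s≤s (s≤s z≤n)))
    ... | inj₁ e = cong (runnerSum t half) e
    ... | inj₂ e = cong (runnerSum t half) (trans (cong c (sym opposite-half)) e)
      where
      opposite-half : opposite half ≡ half
      opposite-half = ℕₚ.+-cancelˡ-≡ half _ _ (trans (r+opposite≡t∸1 (m/n<m t 2 (s≤s (s≤s z≤n))))
                        (ℕₚ.suc-injective (trans (trans t≡half+t%2+half (cong (λ d → half ℕ.+ d ℕ.+ half) odd)) (middle-one half))))
        where
        middle-one : ∀ h → h ℕ.+ 1 ℕ.+ h ≡ suc (h ℕ.+ h)
        middle-one = ℕ-Solver.solve-∀
    offsetSquareSum≡ : offsetSquareSum t half ≡ (t ℕ.* (t ℕ.* t ∸ 1)) / 6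
    offsetSquareSum≡ = begin
      offsetSquareSum t half          ≡⟨ cong (λ T → offsetSquareSum T half) t≡half+t%2+half ⟩
      offsetSquareSum (h+d+h) half    ≡⟨ offsetSquareSum-/6 half (t % 2) t%2≤1 ⟨
      (h+d+h ℕ.* (h+d+h ℕ.* h+d+h ∸ 1)) / 6  ≡⟨ cong (λ T → (T ℕ.* (T ℕ.* T ∸ 1)) / 6) t≡half+t%2+half ⟨
      (t ℕ.* (t ℕ.* t ∸ 1)) / 6       ∎
      where
      h+d+h = half ℕ.+ t % 2 ℕ.+ half
    total : sumTo half (λ k → 4 ℕ.* t ℕ.* (runnerSums c k ℕ.+ runnerSums c (opposite k)) ℕ.+ (t ∸ (2 ℕ.* k ℕ.+ 1)) ℕ.* (t ∸ (2 ℕ.* k ℕ.+ 1)))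
            ≡ 4 ℕ.* t ℕ.* sumTo t (runnerSums c) ℕ.+ (t ℕ.* (t ℕ.* t ∸ 1)) / 6
    total = begin
      _                                                                          ≡⟨ sumTo-+ half _ _ ⟩
      sumTo half (λ k → 4 ℕ.* t ℕ.* (runnerSums c k ℕ.+ runnerSums c (opposite k))) ℕ.+ offsetSquareSum t half
        ≡⟨ cong₂ ℕ._+_ (trans (sumTo-* half (4 ℕ.* t) _) (cong (4 ℕ.* t ℕ.*_) (sym (sumTo-opposite-pairs (runnerSums c) middle-runner)))) offsetSquareSum≡ ⟩
      4 ℕ.* t ℕ.* sumTo t (runnerSums c) ℕ.+ (t ℕ.* (t ℕ.* t ∸ 1)) / 6          ∎

  runnersFrom-cong : ∀ {z z'} → (∀ k → z k ≡ z' k) → ∀ r → runnersFrom z r ≡ runnersFrom z' r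
  runnersFrom-cong z≗z' r with r <? half
  ... | yes r<half = cong posPart (z≗z' _)
  ... | no _ with opposite r <? half
  ...   | yes opp<half = cong negPart (z≗z' _)
  ...   | no _ = refl

  lookup-weights : ∀ c k → lookup (weights c) k ≡ weight c (toℕ k)
  lookup-weights c k = lookup∘tabulate (weight c ∘ toℕ) k

  weights-injective : ∀ c c' → OppositeEmpty c → OppositeEmpty c' → weights c ≡ weights c' → ∀ r → r < t → c r ≡ c' r
  weights-injective c c' empty empty' eq r r<t = begin
    c r                                    ≡⟨ runnersFrom-difference c empty r r<t ⟨
    runnersFrom (difference c ∘ toℕ) r     ≡⟨ runnersFrom-cong same-difference r ⟩
    runnersFrom (difference c' ∘ toℕ) r    ≡⟨ runnersFrom-difference c' empty' r r<t ⟩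
    c' r                                   ∎
    where
    open ≡-Reasoning
    cancel-offset : ∀ a b e → a + e ≡ b + e → a ≡ b
    cancel-offset a b e p = trans (add-sub a e) (trans (cong (_- e) p) (sym (add-sub b e)))
      where
      add-sub : ∀ a e → a ≡ a + e - e
      add-sub = solve-∀
    same-difference : ∀ k → difference c (toℕ k) ≡ difference c' (toℕ k)
    same-difference k = *-cancelˡ-≡ (+ (2 ℕ.* t)) _ _ (cancel-offset _ _ (offset (toℕ k))
                          (trans (sym (lookup-weights c k)) (trans (cong (λ v → lookup v k) eq) (lookup-weights c' k))))

  weights-cong : ∀ c c' → (∀ r → r < t → c r ≡ c' r) → weights c ≡ weights c'
  weights-cong c c' c≗c' = tabulate-cong (λ k → cong₂ (λ a b → + (2 ℕ.* t) * (+ a - + b) + offset (toℕ k))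
                                                   (c≗c' (toℕ k) (<half⇒<t (toℕ<n k))) (c≗c' _ (opposite<t (toℕ k))))

  weights-divisible : ∀ c k → + (2 ℕ.* t) ∣ lookup (weights c) k - offset (toℕ k)
  weights-divisible c k = divides (difference c (toℕ k)) (trans (cong (_- offset (toℕ k)) (lookup-weights c k)) (shape (+ (2 ℕ.* t)) (difference c (toℕ k)) (offset (toℕ k))))
    where
    shape : ∀ A D E → A * D + E - E ≡ D * A
    shape = solve-∀

  weights-runnersFrom : ∀ (w : Vec ℤ half) (z : Fin half → ℤ) → (∀ k → lookup w k - offset (toℕ k) ≡ z k * + (2 ℕ.* t)) →
                        weights (runnersFrom z) ≡ w
  weights-runnersFrom w z eq = trans (tabulate-cong entry) (tabulate∘lookup w)
    where
    shape : ∀ W E Z A → W - E ≡ Z * A → A * Z + E ≡ W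
    shape W E Z A p = trans (rearrange A Z E) (trans (cong (_+ E) (sym p)) (sub-add W E))
      where
      rearrange : ∀ A Z E → A * Z + E ≡ Z * A + E
      rearrange = solve-∀
      sub-add : ∀ W E → W - E + E ≡ W
      sub-add = solve-∀
    entry : ∀ k → weight (runnersFrom z) (toℕ k) ≡ lookup w k
    entry k = trans (cong (λ d → + (2 ℕ.* t) * d + offset (toℕ k)) (difference-runnersFrom z k)) (shape (lookup w k) (offset (toℕ k)) (z k) (+ (2 ℕ.* t)) (eq k))

module Correspondence (t' n : ℕ) where

  open Conjugation using (selfConjugate⇒symmetric; symmetric⇒selfConjugate)
  open DiagonalHooks
  open HookLengths using (HookValue; isCore⇒hookValue-∤; hookValue-∤⇒isCore)
  open RangeSums using (sumTo)
  open Abacus t' using (t; OppositeEmpty; beads; beads-strictlyDecreasing; beads-hookValue-∤; beads-diagonalHookSum; beads-cong; module Runners)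
  open Weights t'
  open import Data.Nat as ℕ using (ℕ; _∸_)
  import Data.Nat.Properties as ℕₚ
  open import Data.Nat.DivMod using (_/_)
  open import Data.Nat.ListAction using (sum)
  open import Data.Nat.Divisibility using (_∣_)
  open import Data.Integer as ℤ using (+_)
  import Data.Integer.Properties as ℤₚ
  open import Data.Integer.Divisibility.Signed using (quotient; ∣ᵤ⇒∣; ∣⇒∣ᵤ) renaming (_∣_ to _∣ᵢ_)
  open import Data.List using (List)
  open import Data.Vec using (lookup)
  open import Data.Fin using (Fin; toℕ)
  open import Data.Product using (Σ; _×_; _,_; proj₁; proj₂)
  open import Relation.Binary.PropositionalEquality
  open import Relation.Nullary using (¬_)

  arms : (x : SC t n) → Σ (List ℕ) (λ as → StrictlyDecreasing as × fromArms as ≡ proj₁ x)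
  arms (λs , (decreasing , positive , _) , selfConj , _) = toArms λs decreasing positive (selfConjugate⇒symmetric decreasing selfConj)

  module Of (x : SC t n) where

    as : List ℕ
    as = proj₁ (arms x)

    as-strictlyDecreasing : StrictlyDecreasing as
    as-strictlyDecreasing = proj₁ (proj₂ (arms x))

    fromArms-as : fromArms as ≡ proj₁ x
    fromArms-as = proj₂ (proj₂ (arms x))

    hookValue-∤ : ∀ h → HookValue as h → ¬ (t ∣ h)
    hookValue-∤ = isCore⇒hookValue-∤ as as-strictlyDecreasing t (subst (IsCore t) (sym fromArms-as) (proj₂ (proj₂ (proj₂ x))))

    open Runners as as-strictlyDecreasing hookValue-∤ public

    size : n ≡ sumTo t (runnerSums runnerLength)
    size = begin
      n                                      ≡⟨ proj₂ (proj₂ (proj₁ (proj₂ x))) ⟨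
      sum (proj₁ x)                          ≡⟨ cong sum fromArms-as ⟨
      sum (fromArms as)                      ≡⟨ fromArms-sum as as-strictlyDecreasing ⟩
      diagonalHookSum as                     ≡⟨ cong diagonalHookSum beads-runnerLength ⟩
      diagonalHookSum (beads runnerLength)   ≡⟨ beads-diagonalHookSum runnerLength ⟩
      sumTo t (runnerSums runnerLength)      ∎
      where open ≡-Reasoning

  encode : SC t n → W t n
  encode x = weights c , sumSq-≡ , λ k → ∣⇒∣ᵤ (weights-divisible c k)
    where
    open Of x
    c : ℕ → ℕ
    c = runnerLength
    sumSq-≡ : sumSq (weights c) ≡ + (4 ℕ.* t ℕ.* n ℕ.+ (t ℕ.* (t ℕ.* t ∸ 1)) / 6)
    sumSq-≡ = trans (sumSq-weights c runnerLength-oppositeEmpty) (cong (λ m → + (4 ℕ.* t ℕ.* m ℕ.+ (t ℕ.* (t ℕ.* t ∸ 1)) / 6)) (sym size))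

  fromArms-beads : ∀ x → fromArms (beads (Of.runnerLength x)) ≡ proj₁ x
  fromArms-beads x = trans (cong fromArms (sym (Of.beads-runnerLength x))) (Of.fromArms-as x)

  encode-injective : ∀ (x y : SC t n) → proj₁ (encode x) ≡ proj₁ (encode y) → proj₁ x ≡ proj₁ y
  encode-injective x y eq = begin
    proj₁ x                                   ≡⟨ fromArms-beads x ⟨
    fromArms (beads (Of.runnerLength x))      ≡⟨ cong fromArms (beads-cong _ _ same-runners) ⟩
    fromArms (beads (Of.runnerLength y))      ≡⟨ fromArms-beads y ⟩
    proj₁ y                                   ∎
    where
    open ≡-Reasoning
    same-runners : ∀ r → r ℕ.< t → Of.runnerLength x r ≡ Of.runnerLength y r
    same-runners = weights-injective _ _ (Of.runnerLength-oppositeEmpty x) (Of.runnerLength-oppositeEmpty y) eq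

  encode-surjective : ∀ (y : W t n) → Σ (SC t n) (λ x → proj₁ (encode x) ≡ proj₁ y)
  encode-surjective (w , sumSq-w , divisible) = x , encode-x≡w
    where
    open ≡-Reasoning
    divisible′ : ∀ k → + (2 ℕ.* t) ∣ᵢ lookup w k ℤ.- offset (toℕ k)
    divisible′ k = ∣ᵤ⇒∣ {+ (2 ℕ.* t)} {lookup w k ℤ.- offset (toℕ k)} (divisible k)
    z : Fin half → ℤ.ℤ
    z k = quotient (divisible′ k)
    c : ℕ → ℕ
    c = runnersFrom z
    empty : OppositeEmpty c
    empty = runnersFrom-oppositeEmpty z
    weights-c≡w : weights c ≡ w
    weights-c≡w = weights-runnersFrom w z (λ k → _∣ᵢ_.equality (divisible′ k))
    s : StrictlyDecreasing (beads c)
    s = beads-strictlyDecreasing c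
    size : n ≡ sumTo t (runnerSums c)
    size = ℕₚ.*-cancelˡ-≡ n _ (4 ℕ.* t) (ℕₚ.+-cancelʳ-≡ _ _ _ (ℤₚ.+-injective (begin
      + (4 ℕ.* t ℕ.* n ℕ.+ K)                        ≡⟨ sumSq-w ⟨
      sumSq w                                       ≡⟨ cong sumSq weights-c≡w ⟨
      sumSq (weights c)                             ≡⟨ sumSq-weights c empty ⟩
      + (4 ℕ.* t ℕ.* sumTo t (runnerSums c) ℕ.+ K)   ∎)))
      where
      K = (t ℕ.* (t ℕ.* t ∸ 1)) / 6
    partition : IsPartitionOf n (fromArms (beads c))
    partition = fromArms-decreasing _ s , fromArms-positive _ ,
                trans (fromArms-sum _ s) (trans (beads-diagonalHookSum c) (sym size))
    x : SC t n
    x = fromArms (beads c) , partition ,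
        symmetric⇒selfConjugate (fromArms-decreasing _ s) (fromArms-positive _) (fromArms-symmetric _ s) ,
        hookValue-∤⇒isCore _ s t (beads-hookValue-∤ c empty)
    same-runners : ∀ r → r ℕ.< t → Of.runnerLength x r ≡ c r
    same-runners = Of.runnerLength-beads x c (fromArms-injective _ _ (Of.as-strictlyDecreasing x) s (Of.fromArms-as x))
    encode-x≡w : weights (Of.runnerLength x) ≡ w
    encode-x≡w = trans (weights-cong _ _ same-runners) weights-c≡w

theorem1p5 : (t n : ℕ) → 1 ≤ t → Σ (SC t n → W t n) (λ f → Bijection f)
theorem1p5 (suc t') n _ = encode , encode-injective , encode-surjective
  where open Correspondence t' n
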